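{- Let $k\ge 4$ be fixed and let $G_k$ be the graph defined in the context, with distinguished vertices $u,a_u,a_v,v$. Let $\alpha,\beta\in\{0,k\}$ and let $x,y$ be integers. There is a $k$-$L(2,1)$-labelling $L$ of $G_k$ with $L(u)=\alpha$, $L(v)=\beta$, $L(a_u)=x$, $L(a_v)=y$ if and only if: (i) if $(\alpha,\beta)=(0,0)$ then $(x,y)\in\{(2,k),(k,2),(k-2,k),(k,k-2)\}$; (ii) if $(\alpha,\beta)=(k,k)$ then $(x,y)\in\{(2,0),(0,2),(k-2,0),(0,k-2)\}$; (iii) if $(\alpha,\beta)=(k,0)$ then $(x,y)=(1,k-1)$; (iv) if $(\alpha,\beta)=(0,k)$ then $(x,y)=(k-1,1)$.
   Context: A $k$-$L(2,1)$-labelling of a graph is a map $L$ from its vertices to $\{0,\dots,k\}$ such that adjacent vertices get labels differing by at least $2$ and vertices at distance $2$ get distinct labels. The gadget $G_k$: For $k=4$: $G_4$ is the path $u,a_u,a_v,v$ (edges $ua_u,a_ua_v,a_vv$). For $k=5$: $G_5$ has vertices $u,a_u,a_v,v,b_u,b_v,c,d,e_1,e_2,e_3,f,g_1,g_2$ and edges $ua_u,a_ua_v,a_vv,a_ub_u,a_vb_v,b_uc,b_vc,cd,de_1,de_2,de_3,e_1f,e_2f,fg_1,fg_2$. For $k\ge 6$: let $H'$ be the graph with vertices $c,d,e,f_1,\dots,f_{k-3},g,h,i$ and edges $cd,de,hg,gi$ and $gf_j,df_j$ for $j=1,\dots,k-3$. Then $G_k$ consists of the path $u,a_u,a_v,v$,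 vertices $b_1,\dots,b_{k-5}$ each adjacent to both $a_u$ and $a_v$, and, for each $i=1,\dots,k-5$, two disjoint copies of $H'$ whose vertex $c$ is joined to $b_i$. -}

module Defs where

open import Data.Nat using (ℕ; zero; suc; _≤_; ∣_-_∣)
open import Data.Fin using (Fin)
open import Data.Sum using (_⊎_)
open import Relation.Binary.PropositionalEquality using (_≡_; _≢_)
open import Relation.Nullary using (¬_)

record Gadget : Set₁ where
  field
    V    : Set
    E    : V → V → Set
    u    : V
    au   : V
    av   : V
    v    : V

  Adj : V → V → Set
  Adj x y = E x y ⊎ E y x

data V4 : Set where
  u au av v : V4

data E4 : V4 → V4 → Set where
  e-u-au  : E4 u au
  e-au-av : E4 au av
  e-av-v  : E4 av v

G4 : Gadget
G4 = record { V = V4 ; E = E4 ; u = u ; au = au ; av = av ; v = v }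

data V5 : Set where
  u au av v bu bv c d e1 e2 e3 f g1 g2 : V5

data E5 : V5 → V5 → Set where
  e-u-au  : E5 u au
  e-au-av : E5 au av
  e-av-v  : E5 av v
  e-au-bu : E5 au bu
  e-av-bv : E5 av bv
  e-bu-c  : E5 bu c
  e-bv-c  : E5 bv c
  e-c-d   : E5 c d
  e-d-e1  : E5 d e1
  e-d-e2  : E5 d e2
  e-d-e3  : E5 d e3
  e-e1-f  : E5 e1 f
  e-e2-f  : E5 e2 f
  e-f-g1  : E5 f g1
  e-f-g2  : E5 f g2

G5 : Gadget
G5 = record { V = V5 ; E = E5 ; u = u ; au = au ; av = av ; v = v }

-- G_k for k = 6 + m  (so k - 5 = suc m and k - 3 = 3 + m)

-- vertices of H' (with f_1..f_{k-3} indexed by Fin (3 + m))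
data H' (m : ℕ) : Set where
  c d e g h i : H' m
  f : Fin (suc (suc (suc m))) → H' m

data EH' (m : ℕ) : H' m → H' m → Set where
  e-c-d : EH' m c d
  e-d-e : EH' m d e
  e-h-g : EH' m h g
  e-g-i : EH' m g i
  e-g-f : (j : Fin (suc (suc (suc m)))) → EH' m g (f j)
  e-d-f : (j : Fin (suc (suc (suc m)))) → EH' m d (f j)

data V6 (m : ℕ) : Set where
  u au av v : V6 m
  b : Fin (suc m) → V6 m
  -- copy (i , s) of H' : i ∈ {1..k-5}, s ∈ {0,1} selects one of the two copies
  hv : Fin (suc m) → Fin 2 → H' m → V6 m

data E6 (m : ℕ) : V6 m → V6 m → Set where
  e-u-au  : E6 m u au
  e-au-av : E6 m au av
  e-av-v  : E6 m av v
  e-au-b  : (i : Fin (suc m)) → E6 m au (b i)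
  e-av-b  : (i : Fin (suc m)) → E6 m av (b i)
  e-b-c   : (i : Fin (suc m)) (s : Fin 2) → E6 m (b i) (hv i s c)
  e-H'    : (i : Fin (suc m)) (s : Fin 2) {x y : H' m} →
            EH' m x y → E6 m (hv i s x) (hv i s y)

G6+ : ℕ → Gadget
G6+ m = record { V = V6 m ; E = E6 m ; u = u ; au = au ; av = av ; v = v }

-- The gadget G_k (only meaningful for k ≥ 4; for k < 4 an irrelevant
-- default is returned, the theorem assumes 4 ≤ k).

G : ℕ → Gadget
G 4 = G4
G 5 = G5
G (suc (suc (suc (suc (suc (suc m)))))) = G6+ m
G _ = G4

record L21 (k : ℕ) (Γ : Gadget) : Set where
  open Gadget Γ
  field
    L       : V → ℕ
    range   : ∀ x → L x ≤ k
    adjDiff : ∀ x y → Adj x y → 2 ≤ ∣ L x - L y ∣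
    dist2   : ∀ x y w → x ≢ y → ¬ Adj x y → Adj x w → Adj w y → L x ≢ L y

module Submission where

-- Reflecting every label, ℓ ↦ k − ℓ, turns a k-L(2,1)-labelling into another one, so the corners
-- (k, k) and (k, 0) reduce to (0, 0) and (0, k).  For each of the three kinds of gadget it thus
-- suffices to realise the pairs listed for (0, 0) and (0, k) and to show that no other pair occurs.
-- The general tools come first: separation of labels, a pigeonhole count of pairwise distinct
-- labels that avoid a chain of values ("crowding"), the consequence that a vertex with k − 1
-- independent neighbours is labelled 0 or k, the reflection of labellings, and a verifier that
-- checks labellings of finite gadgets by evaluation.
--   k = 4, 5: labellings are verified by evaluation; impossible pairs are ruled out by exhaustive
--   search over the few labels that matter (for k = 5 after locating the label of d).
--   k ≥ 6: in each copy of H′ the vertex d is labelled 0 or k with c at the opposite end; this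
--   restricts the k − 5 hubs b_i so much that crowding them leaves only the listed pairs.  The
--   labellings are assembled from labellings of H′, and the symmetry a_u ↔ a_v halves the work.

open import Defs
open import Data.Nat using (ℕ; _≤_; _∸_)
open import Data.Integer using (ℤ; +_)
open import Data.Product using (_×_; _,_; Σ)
open import Data.Sum using (_⊎_)
open import Relation.Binary.PropositionalEquality using (_≡_)
open import Function.Bundles using (_⇔_)

open import Data.Empty using (⊥; ⊥-elim)
open import Data.Fin using (Fin; zero; suc; #_; toℕ)
import Data.Fin.Properties as Fin
open import Data.Fin.Properties using (injective⇒≤; toℕ≤pred[n]; toℕ-injective)
open import Data.List using (List; []; _∷_; _++_; length; applyUpTo; lookup; map)
open import Data.List.Properties using (length-++; length-applyUpTo)
open import Data.List.Membership.Propositional using (_∈_; _∉_)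
import Data.List.Membership.DecPropositional as DecMembership
open import Data.List.Membership.Propositional.Properties using (∈-applyUpTo⁺; ∈-++⁺ˡ; ∈-++⁺ʳ; ∈-map⁺)
open import Data.List.Relation.Unary.All using (All; []; _∷_)
import Data.List.Relation.Unary.All as All
open import Data.List.Relation.Unary.All.Properties using (++⁺)
open import Data.List.Relation.Unary.Any using (index; here; there)
open import Data.List.Relation.Unary.Any.Properties using (lookup-index)
open import Data.Nat using (zero; suc; _+_; _<_; z≤n; s≤s; ∣_-_∣; _≟_; _<?_; _≤?_)
open import Data.Nat.Properties
open import Data.Nat.Tactic.RingSolver using (solve-∀)
open import Data.Product using (proj₁; proj₂; swap)
open import Data.Product.Properties using (≡-dec)
open import Data.Sum using (inj₁; inj₂; [_,_]′)
import Data.Sum as Sum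
open import Data.Vec using ([]; _∷_)
import Data.Vec as Vec
open import Function using (id)
open import Function.Bundles using (mk⇔)
open import Relation.Binary.PropositionalEquality
open import Relation.Nullary using (¬_; Dec; yes; no)
open import Relation.Nullary.Decidable using (True; toWitness; _×-dec_; _⊎-dec_; _→-dec_; ¬?)

Sep : ℕ → ℕ → Set
Sep x y = 2 ≤ ∣ x - y ∣

sep⇒apart : ∀ {x y} → Sep x y → 2 + x ≤ y ⊎ 2 + y ≤ x
sep⇒apart {zero}  {y}     s = inj₁ s
sep⇒apart {suc x} {zero}  s = inj₂ s
sep⇒apart {suc x} {suc y} s with sep⇒apart {x} {y} s
... | inj₁ x+2≤y = inj₁ (s≤s x+2≤y)
... | inj₂ y+2≤x = inj₂ (s≤s y+2≤x)

apart⇒sep : ∀ {x y} → 2 + x ≤ y ⊎ 2 + y ≤ x → Sep x y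
apart⇒sep {zero}  (inj₁ x+2≤y)       = x+2≤y
apart⇒sep {zero}  (inj₂ ())
apart⇒sep {suc x} {zero} (inj₁ ())
apart⇒sep {suc x} {zero} (inj₂ y+2≤x) = y+2≤x
apart⇒sep {suc x} {suc y} (inj₁ (s≤s x+2≤y)) = apart⇒sep {x} {y} (inj₁ x+2≤y)
apart⇒sep {suc x} {suc y} (inj₂ (s≤s y+2≤x)) = apart⇒sep {x} {y} (inj₂ y+2≤x)

sep-sym : ∀ {x y} → Sep x y → Sep y x
sep-sym {x} {y} = subst (2 ≤_) (∣-∣-comm x y)

near⇒¬sep : ∀ {x y} → x ≤ suc y → y ≤ suc x → ¬ Sep x y
near⇒¬sep {x} {y} x≤y+1 y≤x+1 s with sep⇒apart s
... | inj₁ x+2≤y = 1+n≰n (≤-trans x+2≤y y≤x+1)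
... | inj₂ y+2≤x = 1+n≰n (≤-trans y+2≤x x≤y+1)

sep-below : ∀ {ℓ k} → ℓ ≤ k → Sep ℓ k → 2 + ℓ ≤ k
sep-below {ℓ} {k} ℓ≤k s with sep⇒apart {ℓ} {k} s
... | inj₁ ℓ+2≤k = ℓ+2≤k
... | inj₂ k+2≤ℓ = ⊥-elim (1+n≰n (≤-trans (n≤1+n (suc k)) (≤-trans k+2≤ℓ ℓ≤k)))

sep⇒≢self : ∀ {y ℓ} → Sep y ℓ → ℓ ≢ y
sep⇒≢self {y} s refl = near⇒¬sep (n≤1+n y) (n≤1+n y) s

sep⇒≢suc : ∀ {y ℓ} → Sep y ℓ → ℓ ≢ suc y
sep⇒≢suc {y} s refl = near⇒¬sep (m≤n⇒m≤1+n (n≤1+n y)) ≤-refl s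

sep⇒≢pred : ∀ {y ℓ} → Sep (suc y) ℓ → ℓ ≢ y
sep⇒≢pred {y} s refl = near⇒¬sep ≤-refl (m≤n⇒m≤1+n (n≤1+n y)) s

around : ℕ → List ℕ
around t = t ∷ suc t ∷ suc (suc t) ∷ []

sep-avoids : ∀ {t ℓ} → Sep (suc t) ℓ → All (ℓ ≢_) (around t)
sep-avoids s = sep⇒≢pred s ∷ sep⇒≢self s ∷ sep⇒≢suc s ∷ []

Distinct : ∀ {n} → (Fin n → ℕ) → Set
Distinct val = ∀ p q → p ≢ q → val p ≢ val q

distinct-in-list : ∀ {n} (val : Fin n → ℕ) → Distinct val → (A : List ℕ) → (∀ p → val p ∈ A) → n ≤ length A
distinct-in-list {n} val distinct A val∈A = injective⇒≤ position-injective
  where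
  position : Fin n → Fin (length A)
  position p = index (val∈A p)
  position-injective : ∀ {p q} → position p ≡ position q → p ≡ q
  position-injective {p} {q} eq with p Fin.≟ q
  ... | yes p≡q = p≡q
  ... | no p≢q  = ⊥-elim (distinct p q p≢q
      (trans (lookup-index (val∈A p)) (trans (cong (lookup A) eq) (sym (lookup-index (val∈A q))))))

interval : ℕ → ℕ → List ℕ
interval lo hi = applyUpTo (_+_ lo) (hi ∸ lo)

∈-interval : ∀ {lo hi ℓ} → lo ≤ ℓ → ℓ < hi → ℓ ∈ interval lo hi
∈-interval {lo} {hi} lo≤ℓ ℓ<hi =
  subst (_∈ interval lo hi) (m+[n∸m]≡n lo≤ℓ) (∈-applyUpTo⁺ (_+_ lo) (∸-monoˡ-< ℓ<hi lo≤ℓ))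

Chain : ℕ → List ℕ → ℕ → Set
Chain lo []      hi = lo ≤ hi
Chain lo (x ∷ F) hi = lo ≤ x × Chain (suc x) F hi

gaps : ℕ → List ℕ → ℕ → List ℕ
gaps lo []      hi = interval lo hi
gaps lo (x ∷ F) hi = interval lo x ++ gaps (suc x) F hi

∈-gaps : ∀ lo F hi {ℓ} → lo ≤ ℓ → ℓ < hi → All (ℓ ≢_) F → ℓ ∈ gaps lo F hi
∈-gaps lo []      hi lo≤ℓ ℓ<hi []            = ∈-interval lo≤ℓ ℓ<hi
∈-gaps lo (x ∷ F) hi {ℓ} lo≤ℓ ℓ<hi (ℓ≢x ∷ ℓ∉F) with ℓ <? x
... | yes ℓ<x = ∈-++⁺ˡ (∈-interval lo≤ℓ ℓ<x)
... | no  ℓ≮x = ∈-++⁺ʳ (interval lo x)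
      (∈-gaps (suc x) F hi (≤∧≢⇒< (≮⇒≥ ℓ≮x) (λ x≡ℓ → ℓ≢x (sym x≡ℓ))) ℓ<hi ℓ∉F)

length-gaps : ∀ lo F hi → Chain lo F hi → length F + lo + length (gaps lo F hi) ≡ hi
length-gaps lo [] hi lo≤hi = trans (cong (_+_ lo) (length-applyUpTo (_+_ lo) (hi ∸ lo))) (m+[n∸m]≡n lo≤hi)
length-gaps lo (x ∷ F) hi (lo≤x , chain) = begin
  suc (length F) + lo + length (interval lo x ++ rest)
    ≡⟨ cong (_+_ (suc (length F) + lo)) (length-++ (interval lo x)) ⟩
  suc (length F) + lo + (length (interval lo x) + length rest)
    ≡⟨ cong (λ t → suc (length F) + lo + (t + length rest)) (length-applyUpTo (_+_ lo) (x ∸ lo)) ⟩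
  suc (length F) + lo + ((x ∸ lo) + length rest)
    ≡⟨ rearrange (length F) lo (x ∸ lo) (length rest) ⟩
  length F + suc (lo + (x ∸ lo)) + length rest
    ≡⟨ cong (λ y → length F + suc y + length rest) (m+[n∸m]≡n lo≤x) ⟩
  length F + suc x + length rest
    ≡⟨ length-gaps (suc x) F hi chain ⟩
  hi ∎
  where
  open ≡-Reasoning
  rest : List ℕ
  rest = gaps (suc x) F hi
  rearrange : ∀ r lo d g → suc r + lo + (d + g) ≡ r + suc (lo + d) + g
  rearrange = solve-∀

crowding : ∀ {n} lo F hi (val : Fin n → ℕ) → Distinct val → Chain lo F hi →
           (∀ p → lo ≤ val p) → (∀ p → val p < hi) → (∀ p → All (val p ≢_) F) → length F + lo + n ≤ hi
crowding {n} lo F hi val distinct chain lo≤val val<hi avoid =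
  subst (length F + lo + n ≤_) (length-gaps lo F hi chain)
    (+-monoʳ-≤ (length F + lo)
      (distinct-in-list val distinct (gaps lo F hi) (λ p → ∈-gaps lo F hi (lo≤val p) (val<hi p) (avoid p))))

distinct-reindex : ∀ {n n′} {val : Fin n → ℕ} (ι : Fin n′ → Fin n) →
                   (∀ p q → p ≢ q → ι p ≢ ι q) → Distinct val → Distinct (λ p → val (ι p))
distinct-reindex ι ι-injective distinct p q p≢q = distinct (ι p) (ι q) (ι-injective p q p≢q)

Window : ℕ → ℕ → Set
Window lo x = lo ≤ x × x ≤ suc lo

no-three-in-window : ∀ {lo x y z} → x ≢ y → x ≢ z → y ≢ z → Window lo x → Window lo y → Window lo z → ⊥
no-three-in-window {lo} {x} {y} {z} x≢y x≢z y≢z wx wy wz =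
  1+n≰n (distinct-in-list (Vec.lookup (x ∷ y ∷ z ∷ [])) distinct (lo ∷ suc lo ∷ []) member)
  where
  distinct : Distinct (Vec.lookup (x ∷ y ∷ z ∷ []))
  distinct zero             zero             p≢q = ⊥-elim (p≢q refl)
  distinct zero             (suc zero)       _   = x≢y
  distinct zero             (suc (suc zero)) _   = x≢z
  distinct (suc zero)       zero             _   = λ eq → x≢y (sym eq)
  distinct (suc zero)       (suc zero)       p≢q = ⊥-elim (p≢q refl)
  distinct (suc zero)       (suc (suc zero)) _   = y≢z
  distinct (suc (suc zero)) zero             _   = λ eq → x≢z (sym eq)
  distinct (suc (suc zero)) (suc zero)       _   = λ eq → y≢z (sym eq)
  distinct (suc (suc zero)) (suc (suc zero)) p≢q = ⊥-elim (p≢q refl)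
  in-window : ∀ {w} → Window lo w → w ∈ lo ∷ suc lo ∷ []
  in-window {w} (lo≤w , w≤lo+1) with w ≟ lo
  ... | yes w≡lo = here w≡lo
  ... | no  w≢lo = there (here (≤-antisym w≤lo+1 (≤∧≢⇒< lo≤w (λ lo≡w → w≢lo (sym lo≡w)))))
  member : ∀ p → Vec.lookup (x ∷ y ∷ z ∷ []) p ∈ lo ∷ suc lo ∷ []
  member zero             = in-window wx
  member (suc zero)       = in-window wy
  member (suc (suc zero)) = in-window wz

-- A vertex with at least k − 1 neighbours carrying pairwise distinct labels gets label 0 or k:
-- an intermediate label excludes the three labels around it, leaving only k − 2 values.
extreme-label : ∀ {k n ℓ} (val : Fin n → ℕ) → k ≤ suc n → Distinct val →
                (∀ p → val p ≤ k) → (∀ p → Sep ℓ (val p)) → ℓ ≤ k → ℓ ≡ 0 ⊎ ℓ ≡ k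
extreme-label {ℓ = zero} _ _ _ _ _ _ = inj₁ refl
extreme-label {k} {n} {suc t} val k≤n+1 distinct val≤k sep ℓ≤k with suc t ≟ k
... | yes ℓ≡k = inj₂ ℓ≡k
... | no  ℓ≢k = ⊥-elim (1+n≰n (≤-trans (≤-pred crowded) k≤n+1))
  where
  crowded : 3 + n ≤ suc k
  crowded = crowding 0 (around t) (suc k) val distinct (z≤n , ≤-refl , ≤-refl , s≤s (≤∧≢⇒< ℓ≤k ℓ≢k))
              (λ _ → z≤n) (λ p → s≤s (val≤k p)) (λ p → sep-avoids (sep p))

reflect-apart : ∀ {x y k} → 2 + x ≤ y → y ≤ k → 2 + (k ∸ y) ≤ k ∸ x
reflect-apart {zero} {y} {k} 2≤y y≤k = begin
  2 + (k ∸ y) ≤⟨ +-monoˡ-≤ (k ∸ y) 2≤y ⟩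
  y + (k ∸ y) ≡⟨ m+[n∸m]≡n y≤k ⟩
  k           ∎
  where open ≤-Reasoning
reflect-apart {suc x} {suc y} {suc k} (s≤s x+2≤y) (s≤s y≤k) = reflect-apart {x} x+2≤y y≤k

reflect-sep : ∀ {x y k} → x ≤ k → y ≤ k → Sep x y → Sep (k ∸ x) (k ∸ y)
reflect-sep {x} {y} {k} x≤k y≤k s with sep⇒apart {x} {y} s
... | inj₁ x+2≤y = apart⇒sep {k ∸ x} {k ∸ y} (inj₂ (reflect-apart x+2≤y y≤k))
... | inj₂ y+2≤x = apart⇒sep {k ∸ x} {k ∸ y} (inj₁ (reflect-apart y+2≤x x≤k))

mirror : ∀ {k Γ} → L21 k Γ → L21 k Γ
mirror {k} lab = record
  { L       = λ x → k ∸ L x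
  ; range   = λ x → m∸n≤m k (L x)
  ; adjDiff = λ x y xy → reflect-sep (range x) (range y) (adjDiff x y xy)
  ; dist2   = λ x y w x≢y ¬xy xw wy same →
                dist2 x y w x≢y ¬xy xw wy (∸-cancelˡ-≡ (range x) (range y) same)
  }
  where open L21 lab

adj-sym : ∀ {Γ : Gadget} {x y} → Gadget.Adj Γ x y → Gadget.Adj Γ y x
adj-sym (inj₁ xy) = inj₂ xy
adj-sym (inj₂ yx) = inj₁ yx

record Symmetry (Γ : Gadget) : Set where
  module Γ = Gadget Γ
  field
    σ            : Γ.V → Γ.V
    σ-involutive : ∀ x → σ (σ x) ≡ x
    σ-adj        : ∀ {x y} → Γ.Adj x y → Γ.Adj (σ x) (σ y)

relabel : ∀ {k Γ} → Symmetry Γ → L21 k Γ → L21 k Γ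
relabel {Γ = Γ} symmetry lab = record
  { L       = λ x → L (σ x)
  ; range   = λ x → range (σ x)
  ; adjDiff = λ x y xy → adjDiff (σ x) (σ y) (σ-adj xy)
  ; dist2   = λ x y w x≢y x≁y xw wy → dist2 (σ x) (σ y) (σ w) (λ same → x≢y (σ-injective same))
                (λ σxσy → x≁y (subst₂ (Gadget.Adj Γ) (σ-involutive x) (σ-involutive y) (σ-adj σxσy)))
                (σ-adj xw) (σ-adj wy)
  }
  where
  open Symmetry symmetry
  open L21 lab
  σ-injective : ∀ {x y} → σ x ≡ σ y → x ≡ y
  σ-injective {x} {y} same = trans (sym (σ-involutive x)) (trans (cong σ same) (σ-involutive y))

module _ {k : ℕ} {Γ : Gadget} (lab : L21 k Γ) where
  open Gadget Γ
  open L21 lab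

  neighbours-distinct : ∀ {n} (w : V) (nb : Fin n → V) → (∀ p → Adj w (nb p)) →
                        (∀ p q → p ≢ q → nb p ≢ nb q × ¬ Adj (nb p) (nb q)) → Distinct (λ p → L (nb p))
  neighbours-distinct w nb adj independent p q p≢q =
    dist2 (nb p) (nb q) w (proj₁ (independent p q p≢q)) (proj₂ (independent p q p≢q)) (adj-sym {Γ} (adj p)) (adj q)

  extreme-vertex : ∀ {n} (w : V) (nb : Fin n → V) → k ≤ suc n → (∀ p → Adj w (nb p)) →
                   (∀ p q → p ≢ q → nb p ≢ nb q × ¬ Adj (nb p) (nb q)) → L w ≡ 0 ⊎ L w ≡ k
  extreme-vertex w nb k≤n+1 adj independent =
    extreme-label (λ p → L (nb p)) k≤n+1 (neighbours-distinct w nb adj independent)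
      (λ p → range (nb p)) (λ p → adjDiff w (nb p) (adj p)) (range w)

record Spine (Γ : Gadget) : Set where
  module Γ = Gadget Γ
  field
    u-au  : Γ.E Γ.u Γ.au
    au-av : Γ.E Γ.au Γ.av
    av-v  : Γ.E Γ.av Γ.v
    u≢av  : Γ.u ≢ Γ.av
    u≁av  : ¬ Γ.Adj Γ.u Γ.av
    au≢v  : Γ.au ≢ Γ.v
    au≁v  : ¬ Γ.Adj Γ.au Γ.v

PathConstraints : ℕ → ℕ → ℕ → ℕ → Set
PathConstraints α x y β = Sep α x × Sep x y × Sep y β × α ≢ y × x ≢ β

path-constraints : ∀ {k Γ} → Spine Γ → (lab : L21 k Γ) →
  PathConstraints (L21.L lab (Gadget.u Γ)) (L21.L lab (Gadget.au Γ)) (L21.L lab (Gadget.av Γ)) (L21.L lab (Gadget.v Γ))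
path-constraints sp lab =
    adjDiff _ _ (inj₁ u-au) , adjDiff _ _ (inj₁ au-av) , adjDiff _ _ (inj₁ av-v)
  , dist2 _ _ _ u≢av u≁av (inj₁ u-au) (inj₁ au-av) , dist2 _ _ _ au≢v au≁v (inj₁ au-av) (inj₁ av-v)
  where open Spine sp ; open L21 lab

_∈ᶜ?_ : ∀ {n} (e : Fin n × Fin n) (es : List (Fin n × Fin n)) → Dec (e ∈ es)
_∈ᶜ?_ = DecMembership._∈?_ (≡-dec Fin._≟_ Fin._≟_)

found : ∀ {n} {e : Fin n × Fin n} {es} → {ok : True (e ∈ᶜ? es)} → e ∈ es
found {ok = ok} = toWitness ok

record Enumeration (Γ : Gadget) : Set where
  module Γ = Gadget Γ
  field
    size        : ℕ
    code        : Γ.V → Fin size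
    decode      : Fin size → Γ.V
    decode-code : ∀ x → decode (code x) ≡ x
    edges       : List (Fin size × Fin size)
    listed      : ∀ {x y} → Γ.E x y → (code x , code y) ∈ edges

-- On an enumerated gadget the labelling conditions, and independence of a family of
-- vertices, become finite checks that can be settled by evaluation.
module Verification {Γ : Gadget} (en : Enumeration Γ) where
  open Gadget Γ
  open Enumeration en

  arcs : List (Fin size × Fin size)
  arcs = edges ++ map swap edges

  arc : ∀ {x y} → Adj x y → (code x , code y) ∈ arcs
  arc (inj₁ xy) = ∈-++⁺ˡ (listed xy)
  arc (inj₂ yx) = ∈-++⁺ʳ edges (∈-map⁺ swap (listed yx))

  code-injective : ∀ {x y} → code x ≡ code y → x ≡ y
  code-injective {x} {y} same = trans (sym (decode-code x)) (trans (cong decode same) (decode-code y))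

  labelOf : (V → ℕ) → Fin size → ℕ
  labelOf L p = L (decode p)

  Valid : ℕ → (V → ℕ) → Set
  Valid k L = (∀ p → labelOf L p ≤ k)
            × All (λ (p , q) → Sep (labelOf L p) (labelOf L q)) arcs
            × All (λ (p , q) → All (λ (q′ , r) → q ≡ q′ → p ≡ r ⊎ labelOf L p ≢ labelOf L r) arcs) arcs

  valid? : ∀ k L → Dec (Valid k L)
  valid? k L = Fin.all? (λ p → labelOf L p ≤? k)
          ×-dec All.all? (λ (p , q) → 2 ≤? ∣ labelOf L p - labelOf L q ∣) arcs
          ×-dec All.all? (λ (p , q) → All.all? (λ (q′ , r) →
                  (q Fin.≟ q′) →-dec ((p Fin.≟ r) ⊎-dec ¬? (labelOf L p ≟ labelOf L r))) arcs) arcs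

  valid⇒L21 : ∀ {k} (L : V → ℕ) → Valid k L → L21 k Γ
  valid⇒L21 {k} L (in-range , separated , distance-two) = record
    { L       = L
    ; range   = λ x → subst (λ z → L z ≤ k) (decode-code x) (in-range (code x))
    ; adjDiff = λ x y xy → subst₂ (λ x y → Sep (L x) (L y)) (decode-code x) (decode-code y)
                             (All.lookup separated (arc xy))
    ; dist2   = dist2
    }
    where
    dist2 : ∀ x y w → x ≢ y → ¬ Adj x y → Adj x w → Adj w y → L x ≢ L y
    dist2 x y w x≢y _ xw wy with All.lookup (All.lookup distance-two (arc xw)) (arc wy) refl
    ... | inj₁ same-code = ⊥-elim (x≢y (code-injective same-code))
    ... | inj₂ different  = subst₂ (λ x y → L x ≢ L y) (decode-code x) (decode-code y) different

  checked : ∀ k (L : V → ℕ) → {True (valid? k L)} → L21 k Γ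
  checked k L {ok} = valid⇒L21 L (toWitness ok)

  Independent : ∀ {n} → (Fin n → V) → Set
  Independent nb = ∀ p q → p ≡ q ⊎ (code (nb p) ≢ code (nb q) × (code (nb p) , code (nb q)) ∉ arcs)

  independent? : ∀ {n} (nb : Fin n → V) → Dec (Independent nb)
  independent? nb = Fin.all? (λ p → Fin.all? (λ q → (p Fin.≟ q) ⊎-dec
                      (¬? (code (nb p) Fin.≟ code (nb q)) ×-dec ¬? ((code (nb p) , code (nb q)) ∈ᶜ? arcs))))

  independent : ∀ {n} (nb : Fin n → V) → {True (independent? nb)} →
                ∀ p q → p ≢ q → nb p ≢ nb q × ¬ Adj (nb p) (nb q)
  independent nb {ok} p q p≢q with toWitness ok p q
  ... | inj₁ p≡q = ⊥-elim (p≢q p≡q)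
  ... | inj₂ (codes-differ , not-an-arc) = (λ same → codes-differ (cong code same)) , (λ adj → not-an-arc (arc adj))

Labelled : ℕ → ℕ → ℕ → ℕ → ℕ → Set
Labelled k α β x y = Σ (L21 k (G k)) λ lab → let open L21 lab ; module Gk = Gadget (G k) in
  L Gk.u ≡ α × L Gk.v ≡ β × L Gk.au ≡ x × L Gk.av ≡ y

OneOf4 : {A : Set} → (ℕ → A) → ℕ × ℕ → ℕ × ℕ → ℕ × ℕ → ℕ × ℕ → A → A → Set
OneOf4 ι p₁ p₂ p₃ p₄ x y = Image p₁ ⊎ Image p₂ ⊎ Image p₃ ⊎ Image p₄
  where
  Image : ℕ × ℕ → Set
  Image p = (x , y) ≡ (ι (proj₁ p) , ι (proj₂ p))

Corner00 CornerKK : {A : Set} → (ℕ → A) → ℕ → A → A → Set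
Corner00 ι k = OneOf4 ι (2 , k) (k , 2) (k ∸ 2 , k) (k , k ∸ 2)
CornerKK ι k = OneOf4 ι (2 , 0) (0 , 2) (k ∸ 2 , 0) (0 , k ∸ 2)

_≟ᵖ_ : (p q : ℕ × ℕ) → Dec (p ≡ q)
_≟ᵖ_ = ≡-dec _≟_ _≟_

corner00? : ∀ k x y → Dec (Corner00 id k x y)
corner00? k x y =
  ((x , y) ≟ᵖ (2 , k)) ⊎-dec ((x , y) ≟ᵖ (k , 2)) ⊎-dec ((x , y) ≟ᵖ (k ∸ 2 , k)) ⊎-dec ((x , y) ≟ᵖ (k , k ∸ 2))

pathConstraints? : ∀ α x y β → Dec (PathConstraints α x y β)
pathConstraints? α x y β =
  (2 ≤? ∣ α - x ∣) ×-dec (2 ≤? ∣ x - y ∣) ×-dec (2 ≤? ∣ y - β ∣) ×-dec ¬? (α ≟ y) ×-dec ¬? (x ≟ β)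

exhaust₂ : ∀ {P : ℕ → ℕ → Set} (P? : ∀ x y → Dec (P x y)) n →
           {True (allUpTo? (λ x → allUpTo? (P? x) n) n)} → ∀ {x y} → x < n → y < n → P x y
exhaust₂ P? n {ok} x<n y<n = toWitness ok x<n y<n

exhaust₃ : ∀ {P : ℕ → ℕ → ℕ → Set} (P? : ∀ x y z → Dec (P x y z)) n →
           {True (allUpTo? (λ x → allUpTo? (λ y → allUpTo? (P? x y) n) n) n)} →
           ∀ {x y z} → x < n → y < n → z < n → P x y z
exhaust₃ P? n {ok} x<n y<n z<n = toWitness ok x<n y<n z<n

constraints-of : ∀ {k α β x y} → Spine (G k) → Labelled k α β x y → PathConstraints α x y β × x < suc k × y < suc k
constraints-of {k} sp (lab , refl , refl , refl , refl) =
  path-constraints sp lab , s≤s (range (Gadget.au (G k))) , s≤s (range (Gadget.av (G k)))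
  where open L21 lab

spine4 : Spine G4
spine4 = record
  { u-au = e-u-au ; au-av = e-au-av ; av-v = e-av-v
  ; u≢av = λ () ; u≁av = λ { (inj₁ ()) ; (inj₂ ()) }
  ; au≢v = λ () ; au≁v = λ { (inj₁ ()) ; (inj₂ ()) }
  }

enum4 : Enumeration G4
enum4 = record
  { size        = 4
  ; code        = code4
  ; decode      = Vec.lookup (u ∷ au ∷ av ∷ v ∷ [])
  ; decode-code = λ { u → refl ; au → refl ; av → refl ; v → refl }
  ; edges       = (code4 u , code4 au) ∷ (code4 au , code4 av) ∷ (code4 av , code4 v) ∷ []
  ; listed      = λ { e-u-au → found ; e-au-av → found ; e-av-v → found }
  }
  where
  code4 : V4 → Fin 4
  code4 u  = # 0
  code4 au = # 1
  code4 av = # 2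
  code4 v  = # 3

path4 : ℕ → ℕ → ℕ → ℕ → V4 → ℕ
path4 α x y β u  = α
path4 α x y β au = x
path4 α x y β av = y
path4 α x y β v  = β

open Verification enum4 using () renaming (checked to checked4)

-- The corner (0, 0) of G₄ (where k − 2 = 2): the path labelled 0 2 4 0 or 0 4 2 0.
realise00-4 : ∀ {x y} → Corner00 id 4 x y → Labelled 4 0 0 x y
realise00-4 (inj₁ refl)               = checked4 4 (path4 0 2 4 0) , refl , refl , refl , refl
realise00-4 (inj₂ (inj₁ refl))        = checked4 4 (path4 0 4 2 0) , refl , refl , refl , refl
realise00-4 (inj₂ (inj₂ (inj₁ refl))) = checked4 4 (path4 0 2 4 0) , refl , refl , refl , refl
realise00-4 (inj₂ (inj₂ (inj₂ refl))) = checked4 4 (path4 0 4 2 0) , refl , refl , refl , refl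

realise0K-4 : Labelled 4 0 4 3 1
realise0K-4 = checked4 4 (path4 0 3 1 4) , refl , refl , refl , refl

-- On the bare path the path constraints are the whole story.
classify00-4 : ∀ {x y} → Labelled 4 0 0 x y → Corner00 id 4 x y
classify00-4 l with constraints-of spine4 l
... | constraints , x<5 , y<5 =
  exhaust₂ (λ x y → pathConstraints? 0 x y 0 →-dec corner00? 4 x y) 5 x<5 y<5 constraints

classify0K-4 : ∀ {x y} → Labelled 4 0 4 x y → (x , y) ≡ (3 , 1)
classify0K-4 l with constraints-of spine4 l
... | constraints , x<5 , y<5 =
  exhaust₂ (λ x y → pathConstraints? 0 x y 4 →-dec (x , y) ≟ᵖ (3 , 1)) 5 x<5 y<5 constraints

spine5 : Spine G5
spine5 = record
  { u-au = e-u-au ; au-av = e-au-av ; av-v = e-av-v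
  ; u≢av = λ () ; u≁av = λ { (inj₁ ()) ; (inj₂ ()) }
  ; au≢v = λ () ; au≁v = λ { (inj₁ ()) ; (inj₂ ()) }
  }

code5 : V5 → Fin 14
code5 u  = # 0
code5 au = # 1
code5 av = # 2
code5 v  = # 3
code5 bu = # 4
code5 bv = # 5
code5 c  = # 6
code5 d  = # 7
code5 e1 = # 8
code5 e2 = # 9
code5 e3 = # 10
code5 f  = # 11
code5 g1 = # 12
code5 g2 = # 13

enum5 : Enumeration G5
enum5 = record
  { size        = 14
  ; code        = code5
  ; decode      = Vec.lookup (u ∷ au ∷ av ∷ v ∷ bu ∷ bv ∷ c ∷ d ∷ e1 ∷ e2 ∷ e3 ∷ f ∷ g1 ∷ g2 ∷ [])
  ; decode-code = λ { u → refl ; au → refl ; av → refl ; v → refl ; bu → refl ; bv → refl ; c → refl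
                    ; d → refl ; e1 → refl ; e2 → refl ; e3 → refl ; f → refl ; g1 → refl ; g2 → refl }
  ; edges       = map (λ (x , y) → code5 x , code5 y)
                    ( (u , au) ∷ (au , av) ∷ (av , v) ∷ (au , bu) ∷ (av , bv) ∷ (bu , c) ∷ (bv , c) ∷ (c , d)
                    ∷ (d , e1) ∷ (d , e2) ∷ (d , e3) ∷ (e1 , f) ∷ (e2 , f) ∷ (f , g1) ∷ (f , g2) ∷ [])
  ; listed      = λ { e-u-au → found ; e-au-av → found ; e-av-v → found ; e-au-bu → found
                    ; e-av-bv → found ; e-bu-c → found ; e-bv-c → found ; e-c-d → found ; e-d-e1 → found
                    ; e-d-e2 → found ; e-d-e3 → found ; e-e1-f → found ; e-e2-f → found ; e-f-g1 → found
                    ; e-f-g2 → found }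
  }

open Verification enum5 using () renaming (checked to checked5; independent to independent5)

labels5 : Vec.Vec ℕ 14 → V5 → ℕ
labels5 ls x = Vec.lookup ls (code5 x)

realise00-5 : ∀ {x y} → Corner00 id 5 x y → Labelled 5 0 0 x y
realise00-5 (inj₁ refl) =
  checked5 5 (labels5 (0 ∷ 2 ∷ 5 ∷ 0 ∷ 4 ∷ 3 ∷ 0 ∷ 5 ∷ 2 ∷ 3 ∷ 1 ∷ 0 ∷ 4 ∷ 5 ∷ [])) , refl , refl , refl , refl
realise00-5 (inj₂ (inj₁ refl)) =
  checked5 5 (labels5 (0 ∷ 5 ∷ 2 ∷ 0 ∷ 3 ∷ 4 ∷ 0 ∷ 5 ∷ 2 ∷ 3 ∷ 1 ∷ 0 ∷ 4 ∷ 5 ∷ [])) , refl , refl , refl , refl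
realise00-5 (inj₂ (inj₂ (inj₁ refl))) =
  checked5 5 (labels5 (0 ∷ 3 ∷ 5 ∷ 0 ∷ 1 ∷ 2 ∷ 4 ∷ 0 ∷ 2 ∷ 3 ∷ 5 ∷ 5 ∷ 0 ∷ 1 ∷ [])) , refl , refl , refl , refl
realise00-5 (inj₂ (inj₂ (inj₂ refl))) =
  checked5 5 (labels5 (0 ∷ 5 ∷ 3 ∷ 0 ∷ 2 ∷ 1 ∷ 4 ∷ 0 ∷ 2 ∷ 3 ∷ 5 ∷ 5 ∷ 0 ∷ 1 ∷ [])) , refl , refl , refl , refl

realise0K-5 : Labelled 5 0 5 4 1
realise0K-5 =
  checked5 5 (labels5 (0 ∷ 4 ∷ 1 ∷ 5 ∷ 2 ∷ 3 ∷ 0 ∷ 5 ∷ 2 ∷ 3 ∷ 1 ∷ 0 ∷ 4 ∷ 5 ∷ [])) , refl , refl , refl , refl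

-- In G₅ the label of d is extreme, and c sits at the opposite end of the range.
Tail5 : ℕ → ℕ → Set
Tail5 r s = (s ≡ 0 × 4 ≤ r) ⊎ (s ≡ 5 × r ≤ 1)

-- c, e₁, e₂ are neighbours of d with distinct labels, and e₁, e₂ are also neighbours of f.
TailConstraints : ℕ → ℕ → ℕ → ℕ → ℕ → Set
TailConstraints dl fl r e₁ e₂ =
  Sep dl r × Sep dl e₁ × Sep dl e₂ × Sep e₁ fl × Sep e₂ fl × r ≢ e₁ × r ≢ e₂ × e₁ ≢ e₂

tailConstraints? : ∀ dl fl r e₁ e₂ → Dec (TailConstraints dl fl r e₁ e₂)
tailConstraints? dl fl r e₁ e₂ =
  (2 ≤? ∣ dl - r ∣) ×-dec (2 ≤? ∣ dl - e₁ ∣) ×-dec (2 ≤? ∣ dl - e₂ ∣) ×-dec (2 ≤? ∣ e₁ - fl ∣)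
  ×-dec (2 ≤? ∣ e₂ - fl ∣) ×-dec ¬? (r ≟ e₁) ×-dec ¬? (r ≟ e₂) ×-dec ¬? (e₁ ≟ e₂)

-- d and f both have k − 1 = 4 independent neighbours, so they are labelled 0 and 5 in some
-- order (they are at distance two); an exhaustive search over c, e₁, e₂ then places c.
tail5 : (lab : L21 5 G5) → Tail5 (L21.L lab c) (L21.L lab d)
tail5 lab = settle (extreme-vertex lab d around-d ≤-refl adj-d (independent5 around-d))
                   (extreme-vertex lab f around-f ≤-refl adj-f (independent5 around-f))
  where
  open L21 lab
  around-d around-f : Fin 4 → V5
  around-d = Vec.lookup (c ∷ e1 ∷ e2 ∷ e3 ∷ [])
  around-f = Vec.lookup (e1 ∷ e2 ∷ g1 ∷ g2 ∷ [])
  adj-d : ∀ p → Gadget.Adj G5 d (around-d p)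
  adj-d zero                   = inj₂ e-c-d
  adj-d (suc zero)             = inj₁ e-d-e1
  adj-d (suc (suc zero))       = inj₁ e-d-e2
  adj-d (suc (suc (suc zero))) = inj₁ e-d-e3
  adj-f : ∀ p → Gadget.Adj G5 f (around-f p)
  adj-f zero                   = inj₂ e-e1-f
  adj-f (suc zero)             = inj₂ e-e2-f
  adj-f (suc (suc zero))       = inj₁ e-f-g1
  adj-f (suc (suc (suc zero))) = inj₁ e-f-g2
  d≢f : L d ≢ L f
  d≢f = dist2 d f e1 (λ ()) (λ { (inj₁ ()) ; (inj₂ ()) }) (inj₁ e-d-e1) (inj₁ e-e1-f)
  constraints : TailConstraints (L d) (L f) (L c) (L e1) (L e2)
  constraints = adjDiff d c (inj₂ e-c-d) , adjDiff d e1 (inj₁ e-d-e1) , adjDiff d e2 (inj₁ e-d-e2)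
              , adjDiff e1 f (inj₁ e-e1-f) , adjDiff e2 f (inj₁ e-e2-f)
              , dist2 c e1 d (λ ()) (λ { (inj₁ ()) ; (inj₂ ()) }) (inj₁ e-c-d) (inj₁ e-d-e1)
              , dist2 c e2 d (λ ()) (λ { (inj₁ ()) ; (inj₂ ()) }) (inj₁ e-c-d) (inj₁ e-d-e2)
              , dist2 e1 e2 d (λ ()) (λ { (inj₁ ()) ; (inj₂ ()) }) (inj₂ e-d-e1) (inj₁ e-d-e2)
  at-ends : ∀ {dl fl} → L d ≡ dl → L f ≡ fl → TailConstraints dl fl (L c) (L e1) (L e2)
  at-ends refl refl = constraints
  settle : L d ≡ 0 ⊎ L d ≡ 5 → L f ≡ 0 ⊎ L f ≡ 5 → Tail5 (L c) (L d)
  settle (inj₁ d0) (inj₁ f0) = ⊥-elim (d≢f (trans d0 (sym f0)))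
  settle (inj₂ d5) (inj₂ f5) = ⊥-elim (d≢f (trans d5 (sym f5)))
  settle (inj₁ d0) (inj₂ f5) = inj₁ (d0 , exhaust₃ (λ r e₁ e₂ → tailConstraints? 0 5 r e₁ e₂ →-dec 4 ≤? r) 6
    (s≤s (range c)) (s≤s (range e1)) (s≤s (range e2)) (at-ends d0 f5))
  settle (inj₂ d5) (inj₁ f0) = inj₂ (d5 , exhaust₃ (λ r e₁ e₂ → tailConstraints? 5 0 r e₁ e₂ →-dec r ≤? 1) 6
    (s≤s (range c)) (s≤s (range e1)) (s≤s (range e2)) (at-ends d5 f0))

-- The constraints next to the path in G₅: labels p, q, r of b_u, b_v, c against labels
-- α, β, x, y of u, v, a_u, a_v, where d (at distance two from b_u and b_v) has the extreme
-- label opposite to c.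
Wings : ℕ → ℕ → ℕ → ℕ → ℕ → ℕ → ℕ → Set
Wings α β x y p q r = Sep x p × α ≢ p × y ≢ p × Sep y q × β ≢ q × x ≢ q × Sep p r × Sep q r
                    × ((4 ≤ r × p ≢ 0 × q ≢ 0) ⊎ (r ≤ 1 × p ≢ 5 × q ≢ 5))

wings? : ∀ α β x y p q r → Dec (Wings α β x y p q r)
wings? α β x y p q r =
  (2 ≤? ∣ x - p ∣) ×-dec ¬? (α ≟ p) ×-dec ¬? (y ≟ p)
  ×-dec (2 ≤? ∣ y - q ∣) ×-dec ¬? (β ≟ q) ×-dec ¬? (x ≟ q)
  ×-dec (2 ≤? ∣ p - r ∣) ×-dec (2 ≤? ∣ q - r ∣)
  ×-dec (((4 ≤? r) ×-dec ¬? (p ≟ 0) ×-dec ¬? (q ≟ 0)) ⊎-dec ((r ≤? 1) ×-dec ¬? (p ≟ 5) ×-dec ¬? (q ≟ 5)))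

wings5 : (lab : L21 5 G5) → let open L21 lab in Wings (L u) (L v) (L au) (L av) (L bu) (L bv) (L c)
wings5 lab =
    adjDiff au bu (inj₁ e-au-bu)
  , dist2 u bu au (λ ()) (λ { (inj₁ ()) ; (inj₂ ()) }) (inj₁ e-u-au) (inj₁ e-au-bu)
  , dist2 av bu au (λ ()) (λ { (inj₁ ()) ; (inj₂ ()) }) (inj₂ e-au-av) (inj₁ e-au-bu)
  , adjDiff av bv (inj₁ e-av-bv)
  , dist2 v bv av (λ ()) (λ { (inj₁ ()) ; (inj₂ ()) }) (inj₂ e-av-v) (inj₁ e-av-bv)
  , dist2 au bv av (λ ()) (λ { (inj₁ ()) ; (inj₂ ()) }) (inj₁ e-au-av) (inj₁ e-av-bv)
  , adjDiff bu c (inj₁ e-bu-c) , adjDiff bv c (inj₁ e-bv-c)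
  , ends (tail5 lab)
  where
  open L21 lab
  bu≢d : L bu ≢ L d
  bu≢d = dist2 bu d c (λ ()) (λ { (inj₁ ()) ; (inj₂ ()) }) (inj₁ e-bu-c) (inj₁ e-c-d)
  bv≢d : L bv ≢ L d
  bv≢d = dist2 bv d c (λ ()) (λ { (inj₁ ()) ; (inj₂ ()) }) (inj₁ e-bv-c) (inj₁ e-c-d)
  ends : Tail5 (L c) (L d) → (4 ≤ L c × L bu ≢ 0 × L bv ≢ 0) ⊎ (L c ≤ 1 × L bu ≢ 5 × L bv ≢ 5)
  ends (inj₁ (d0 , c≥4)) = inj₁ (c≥4 , subst (L bu ≢_) d0 bu≢d , subst (L bv ≢_) d0 bv≢d)
  ends (inj₂ (d5 , c≤1)) = inj₂ (c≤1 , subst (L bu ≢_) d5 bu≢d , subst (L bv ≢_) d5 bv≢d)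

no-room5 : ∀ {α β x y} → {ok : True (allUpTo? (λ p → allUpTo? (λ q → allUpTo? (λ r →
             ¬? (wings? α β x y p q r)) 6) 6) 6)} → ¬ Labelled 5 α β x y
no-room5 {ok = ok} (lab , refl , refl , refl , refl) =
  exhaust₃ (λ p q r → ¬? (wings? (L u) (L v) (L au) (L av) p q r)) 6 {ok}
    (s≤s (range bu)) (s≤s (range bv)) (s≤s (range c)) (wings5 lab)
  where open L21 lab

-- The path alone leaves (2, 4) and (4, 2) besides the corner pairs; b_u, b_v and c exclude them.
classify00-5 : ∀ {x y} → Labelled 5 0 0 x y → Corner00 id 5 x y
classify00-5 l with constraints-of spine5 l
... | constraints , x<6 , y<6
    with exhaust₂ (λ x y → pathConstraints? 0 x y 0 →-dec
                     (corner00? 5 x y ⊎-dec (x , y) ≟ᵖ (2 , 4) ⊎-dec (x , y) ≟ᵖ (4 , 2))) 6 x<6 y<6 constraints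
...    | inj₁ corner           = corner
...    | inj₂ (inj₁ refl)      = ⊥-elim (no-room5 l)
...    | inj₂ (inj₂ refl)      = ⊥-elim (no-room5 l)

-- For (0, k) the path leaves (3, 1) and (4, 2) as well; again excluded by b_u, b_v and c.
classify0K-5 : ∀ {x y} → Labelled 5 0 5 x y → (x , y) ≡ (4 , 1)
classify0K-5 l with constraints-of spine5 l
... | constraints , x<6 , y<6
    with exhaust₂ (λ x y → pathConstraints? 0 x y 5 →-dec
                     ((x , y) ≟ᵖ (4 , 1) ⊎-dec (x , y) ≟ᵖ (3 , 1) ⊎-dec (x , y) ≟ᵖ (4 , 2))) 6 x<6 y<6 constraints
...    | inj₁ corner           = corner
...    | inj₂ (inj₁ refl)      = ⊥-elim (no-room5 l)
...    | inj₂ (inj₂ refl)      = ⊥-elim (no-room5 l)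

module Large (m : ℕ) where

  K : ℕ
  K = 6 + m

  Adj : V6 m → V6 m → Set
  Adj = Gadget.Adj (G6+ m)

  spine : Spine (G6+ m)
  spine = record
    { u-au = e-u-au ; au-av = e-au-av ; av-v = e-av-v
    ; u≢av = λ () ; u≁av = λ { (inj₁ ()) ; (inj₂ ()) }
    ; au≢v = λ () ; au≁v = λ { (inj₁ ()) ; (inj₂ ()) }
    }

  flip-ends : V6 m → V6 m
  flip-ends u  = v
  flip-ends au = av
  flip-ends av = au
  flip-ends v  = u
  flip-ends x  = x

  reflection : Symmetry (G6+ m)
  reflection = record
    { σ            = flip-ends
    ; σ-involutive = λ { u → refl ; au → refl ; av → refl ; v → refl ; (b _) → refl ; (hv _ _ _) → refl }
    ; σ-adj        = λ { (inj₁ xy) → flip-edge xy ; (inj₂ yx) → adj-sym {G6+ m} (flip-edge yx) }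
    }
    where
    flip-edge : ∀ {x y} → E6 m x y → Adj (flip-ends x) (flip-ends y)
    flip-edge e-u-au        = inj₂ e-av-v
    flip-edge e-au-av       = inj₂ e-au-av
    flip-edge e-av-v        = inj₂ e-u-au
    flip-edge (e-au-b p)    = inj₁ (e-av-b p)
    flip-edge (e-av-b p)    = inj₁ (e-au-b p)
    flip-edge (e-b-c p s)   = inj₁ (e-b-c p s)
    flip-edge (e-H' p s xy) = inj₁ (e-H' p s xy)

  swap-labelled : ∀ {α β x y} → Labelled K α β x y → Labelled K β α y x
  swap-labelled (lab , u-α , v-β , au-x , av-y) = relabel reflection lab , v-β , u-α , av-y , au-x

  module InCopy (lab : L21 K (G6+ m)) (p : Fin (suc m)) (s : Fin 2) where
    open L21 lab

    at : H' m → V6 m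
    at = hv p s

    around-d around-g : Fin (5 + m) → V6 m
    around-d zero          = at c
    around-d (suc zero)    = at e
    around-d (suc (suc j)) = at (f j)
    around-g zero          = at h
    around-g (suc zero)    = at i
    around-g (suc (suc j)) = at (f j)

    adj-d : ∀ q → Adj (at d) (around-d q)
    adj-d zero          = inj₂ (e-H' p s e-c-d)
    adj-d (suc zero)    = inj₁ (e-H' p s e-d-e)
    adj-d (suc (suc j)) = inj₁ (e-H' p s (e-d-f j))

    adj-g : ∀ q → Adj (at g) (around-g q)
    adj-g zero          = inj₂ (e-H' p s e-h-g)
    adj-g (suc zero)    = inj₁ (e-H' p s e-g-i)
    adj-g (suc (suc j)) = inj₁ (e-H' p s (e-g-f j))

    f-injective : ∀ {j j′} → at (f j) ≡ at (f j′) → j ≡ j′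
    f-injective refl = refl

    independent-d : ∀ q r → q ≢ r → around-d q ≢ around-d r × ¬ Adj (around-d q) (around-d r)
    independent-d zero          zero           q≢r = ⊥-elim (q≢r refl)
    independent-d zero          (suc zero)     _   = (λ ()) , λ { (inj₁ (e-H' _ _ ())) ; (inj₂ (e-H' _ _ ())) }
    independent-d zero          (suc (suc j))  _   = (λ ()) , λ { (inj₁ (e-H' _ _ ())) ; (inj₂ (e-H' _ _ ())) }
    independent-d (suc zero)    zero           _   = (λ ()) , λ { (inj₁ (e-H' _ _ ())) ; (inj₂ (e-H' _ _ ())) }
    independent-d (suc zero)    (suc zero)     q≢r = ⊥-elim (q≢r refl)
    independent-d (suc zero)    (suc (suc j))  _   = (λ ()) , λ { (inj₁ (e-H' _ _ ())) ; (inj₂ (e-H' _ _ ())) }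
    independent-d (suc (suc j)) zero           _   = (λ ()) , λ { (inj₁ (e-H' _ _ ())) ; (inj₂ (e-H' _ _ ())) }
    independent-d (suc (suc j)) (suc zero)     _   = (λ ()) , λ { (inj₁ (e-H' _ _ ())) ; (inj₂ (e-H' _ _ ())) }
    independent-d (suc (suc j)) (suc (suc j′)) q≢r =
      (λ same → q≢r (cong (λ j → suc (suc j)) (f-injective same))) , λ { (inj₁ (e-H' _ _ ())) ; (inj₂ (e-H' _ _ ())) }

    independent-g : ∀ q r → q ≢ r → around-g q ≢ around-g r × ¬ Adj (around-g q) (around-g r)
    independent-g zero          zero           q≢r = ⊥-elim (q≢r refl)
    independent-g zero          (suc zero)     _   = (λ ()) , λ { (inj₁ (e-H' _ _ ())) ; (inj₂ (e-H' _ _ ())) }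
    independent-g zero          (suc (suc j))  _   = (λ ()) , λ { (inj₁ (e-H' _ _ ())) ; (inj₂ (e-H' _ _ ())) }
    independent-g (suc zero)    zero           _   = (λ ()) , λ { (inj₁ (e-H' _ _ ())) ; (inj₂ (e-H' _ _ ())) }
    independent-g (suc zero)    (suc zero)     q≢r = ⊥-elim (q≢r refl)
    independent-g (suc zero)    (suc (suc j))  _   = (λ ()) , λ { (inj₁ (e-H' _ _ ())) ; (inj₂ (e-H' _ _ ())) }
    independent-g (suc (suc j)) zero           _   = (λ ()) , λ { (inj₁ (e-H' _ _ ())) ; (inj₂ (e-H' _ _ ())) }
    independent-g (suc (suc j)) (suc zero)     _   = (λ ()) , λ { (inj₁ (e-H' _ _ ())) ; (inj₂ (e-H' _ _ ())) }
    independent-g (suc (suc j)) (suc (suc j′)) q≢r =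
      (λ same → q≢r (cong (λ j → suc (suc j)) (f-injective same))) , λ { (inj₁ (e-H' _ _ ())) ; (inj₂ (e-H' _ _ ())) }

    d-extreme : L (at d) ≡ 0 ⊎ L (at d) ≡ K
    d-extreme = extreme-vertex lab (at d) around-d ≤-refl adj-d independent-d

    g-extreme : L (at g) ≡ 0 ⊎ L (at g) ≡ K
    g-extreme = extreme-vertex lab (at g) around-g ≤-refl adj-g independent-g

    d≢g : L (at d) ≢ L (at g)
    d≢g = dist2 (at d) (at g) (at (f zero)) (λ ()) (λ { (inj₁ (e-H' _ _ ())) ; (inj₂ (e-H' _ _ ())) })
            (adj-d (suc (suc zero))) (inj₂ (e-H' p s (e-g-f zero)))

    skip-e : Fin (4 + m) → Fin (5 + m)
    skip-e zero    = zero
    skip-e (suc j) = suc (suc j)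

    skip-e-injective : ∀ q r → q ≢ r → skip-e q ≢ skip-e r
    skip-e-injective zero    zero    q≢r  = ⊥-elim (q≢r refl)
    skip-e-injective zero    (suc r) _    = λ ()
    skip-e-injective (suc q) zero    _    = λ ()
    skip-e-injective (suc q) (suc r) q≢r  = λ same → q≢r (cong suc (Fin.suc-injective (Fin.suc-injective same)))

    -- With d at 0 and g at K, the labels of c and of the k − 3 vertices f_j are pairwise
    -- distinct and at least 2, and those of the f_j are at most K − 2; as [2, K − 2] has only
    -- k − 3 values, c is pushed up to K − 1 or K.
    c-high : L (at d) ≡ 0 → L (at g) ≡ K → 5 + m ≤ L (at c)
    c-high d0 gK with 5 + m ≤? L (at c)
    ... | yes c-high = c-high
    ... | no  c-low  = ⊥-elim (1+n≰n (crowding 2 [] (5 + m) (λ q → L (around-d (skip-e q)))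
            (distinct-reindex skip-e skip-e-injective (neighbours-distinct lab (at d) around-d adj-d independent-d))
            (s≤s (s≤s z≤n)) at-least-2 below-K-1 (λ _ → [])))
      where
      at-least-2 : ∀ q → 2 ≤ L (around-d (skip-e q))
      at-least-2 q = subst (λ x → Sep x (L (around-d (skip-e q)))) d0 (adjDiff _ _ (adj-d (skip-e q)))
      below-K-1 : ∀ q → L (around-d (skip-e q)) < 5 + m
      below-K-1 zero    = ≰⇒> c-low
      below-K-1 (suc j) = ≤-pred (sep-below (range (at (f j)))
                            (subst (Sep (L (at (f j)))) gK (adjDiff _ _ (inj₂ (e-H' p s (e-g-f j))))))

  reflect-low : ∀ {x} → 5 + m ≤ K ∸ x → x ≤ 1
  reflect-low {zero}        _ = z≤n
  reflect-low {suc zero}    _ = s≤s z≤n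
  reflect-low {suc (suc x)} high = ⊥-elim (1+n≰n (≤-trans high (m∸n≤m (4 + m) x)))

  -- In every copy of H′, d carries an extreme label and c sits at the opposite end.
  Tail : ℕ → ℕ → Set
  Tail r t = (t ≡ 0 × 5 + m ≤ r) ⊎ (t ≡ K × r ≤ 1)

  -- By the count in c-high, applied to the labelling or to its reflection.
  tail : (lab : L21 K (G6+ m)) (p : Fin (suc m)) (s : Fin 2) →
         Tail (L21.L lab (hv p s c)) (L21.L lab (hv p s d))
  tail lab p s with InCopy.d-extreme lab p s | InCopy.g-extreme lab p s
  ... | inj₁ d0 | inj₁ g0 = ⊥-elim (InCopy.d≢g lab p s (trans d0 (sym g0)))
  ... | inj₂ dK | inj₂ gK = ⊥-elim (InCopy.d≢g lab p s (trans dK (sym gK)))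
  ... | inj₁ d0 | inj₂ gK = inj₁ (d0 , InCopy.c-high lab p s d0 gK)
  ... | inj₂ dK | inj₁ g0 = inj₂ (dK , reflect-low
          (InCopy.c-high (mirror lab) p s (trans (cong (K ∸_) dK) (n∸n≡0 K)) (cong (K ∸_) g0)))

  module AtHub (lab : L21 K (G6+ m)) (p : Fin (suc m)) where
    open L21 lab

    twins-distinct : L (hv p zero c) ≢ L (hv p (suc zero) c)
    twins-distinct = dist2 _ _ (b p) (λ ()) (λ { (inj₁ ()) ; (inj₂ ()) })
                       (inj₂ (e-b-c p zero)) (inj₁ (e-b-c p (suc zero)))

    hub≢d : ∀ s → L (b p) ≢ L (hv p s d)
    hub≢d s = dist2 _ _ (hv p s c) (λ ()) (λ { (inj₁ ()) ; (inj₂ ()) }) (inj₁ (e-b-c p s)) (inj₁ (e-H' p s e-c-d))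

    hub-sep-c : ∀ s → Sep (L (b p)) (L (hv p s c))
    hub-sep-c s = adjDiff _ _ (inj₁ (e-b-c p s))

    hub-far-c : ∀ s {ℓ} → L (b p) ≡ ℓ → ℓ ≤ suc (L (hv p s c)) → L (hv p s c) ≤ suc ℓ → ⊥
    hub-far-c s refl ℓ≤c+1 c≤ℓ+1 = near⇒¬sep ℓ≤c+1 c≤ℓ+1 (hub-sep-c s)

    -- The label K is unavailable: next to a c labelled K − 1 or K, or equal to the label K of d.
    hub≢K : L (b p) ≢ K
    hub≢K hub≡K with tail lab p zero
    ... | inj₁ (_ , c-high) = hub-far-c zero hub≡K (s≤s c-high) (m≤n⇒m≤1+n (range _))
    ... | inj₂ (dK , _)      = hub≢d zero (trans hub≡K (sym dK))

    -- A hub labelled 1 forces both c's into {K − 1, K}; one labelled K − 1 forces them into {0, 1}.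
    -- Either way a third label in that window, distinct from both, is impossible.
    hub≢1 : ∀ {ℓ} → Window (5 + m) ℓ → ℓ ≢ L (hv p zero c) → ℓ ≢ L (hv p (suc zero) c) → L (b p) ≢ 1
    hub≢1 wℓ ℓ≢c₀ ℓ≢c₁ hub≡1 =
      no-three-in-window ℓ≢c₀ ℓ≢c₁ twins-distinct wℓ (window zero) (window (suc zero))
      where
      window : ∀ s → Window (5 + m) (L (hv p s c))
      window s with tail lab p s
      ... | inj₁ (_ , c-high) = c-high , range _
      ... | inj₂ (_ , c≤1)    = ⊥-elim (hub-far-c s hub≡1 (s≤s z≤n) (m≤n⇒m≤1+n c≤1))

    hub≢K-1 : ∀ {ℓ} → ℓ ≤ 1 → ℓ ≢ L (hv p zero c) → ℓ ≢ L (hv p (suc zero) c) → L (b p) ≢ 5 + m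
    hub≢K-1 ℓ≤1 ℓ≢c₀ ℓ≢c₁ hub≡K-1 =
      no-three-in-window ℓ≢c₀ ℓ≢c₁ twins-distinct (z≤n , ℓ≤1) (window zero) (window (suc zero))
      where
      window : ∀ s → Window 0 (L (hv p s c))
      window s with tail lab p s
      ... | inj₁ (_ , c-high) = ⊥-elim (hub-far-c s hub≡K-1 (m≤n⇒m≤1+n c-high) (range _))
      ... | inj₂ (_ , c≤1)    = z≤n , c≤1

  -- The m + 1 hubs b_p, once u is labelled 0: their labels are pairwise distinct (common
  -- neighbour a_u) and lie in [1, K − 1], so any six labels they all avoid leave room for only m.
  module Hubs (lab : L21 K (G6+ m)) (u0 : L21.L lab u ≡ 0) where
    open L21 lab

    B : Fin (suc m) → ℕ
    B p = L (b p)

    b-injective : ∀ {p q} → b {m} p ≡ b q → p ≡ q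
    b-injective refl = refl

    B-distinct : Distinct B
    B-distinct = neighbours-distinct lab au b (λ p → inj₁ (e-au-b p))
                   (λ p q p≢q → (λ same → p≢q (b-injective same)) , λ { (inj₁ ()) ; (inj₂ ()) })

    B≢0 : ∀ p → B p ≢ 0
    B≢0 p B≡0 = dist2 u (b p) au (λ ()) (λ { (inj₁ ()) ; (inj₂ ()) }) (inj₁ e-u-au) (inj₁ (e-au-b p))
                  (trans u0 (sym B≡0))

    B<K : ∀ p → B p < K
    B<K p = ≤∧≢⇒< (range (b p)) (AtHub.hub≢K lab p)

    crowded : (F : List ℕ) → Chain 0 F K → 6 ≤ length F → (∀ p → All (B p ≢_) F) → ⊥
    crowded F chain six≤F avoid = 1+n≰n (+-cancelˡ-≤ 6 _ _ (≤-trans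
      (+-monoˡ-≤ (suc m) (≤-trans six≤F (m≤m+n (length F) 0)))
      (crowding 0 F K B B-distinct chain (λ _ → z≤n) B<K avoid)))

    low-pair : ∀ {t y} → 1 ≤ t → 3 + t ≤ y → y ≤ 4 + m →
               (∀ p → Sep (suc t) (B p)) → (∀ p → Sep y (B p)) → ⊥
    low-pair {t} {y} 1≤t t+3≤y y≤4+m sep-x sep-y = crowded (0 ∷ around t ++ y ∷ suc y ∷ [])
      (z≤n , 1≤t , ≤-refl , ≤-refl , t+3≤y , ≤-refl , s≤s (s≤s y≤4+m)) ≤-refl
      (λ p → B≢0 p ∷ ++⁺ (sep-avoids (sep-x p)) (sep⇒≢self (sep-y p) ∷ sep⇒≢suc (sep-y p) ∷ []))

    two-and-top : (∀ p → Sep 2 (B p)) → (∀ p → Sep (5 + m) (B p)) → ⊥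
    two-and-top sep-x sep-y = crowded (0 ∷ around 1 ++ 4 + m ∷ 5 + m ∷ [])
      (z≤n , s≤s z≤n , ≤-refl , ≤-refl , s≤s (s≤s (s≤s (s≤s z≤n))) , ≤-refl , ≤-refl) ≤-refl
      (λ p → B≢0 p ∷ ++⁺ (sep-avoids (sep-x p)) (sep⇒≢pred (sep-y p) ∷ sep⇒≢self (sep-y p) ∷ []))

    middle-and-ends : ∀ {t} → 2 ≤ t → t ≤ 2 + m → (∀ p → Sep (suc t) (B p)) →
                      (∀ p → B p ≢ 1) → (∀ p → B p ≢ 5 + m) → ⊥
    middle-and-ends 2≤t t≤2+m sep-x B≢1 B≢K-1 = crowded (0 ∷ 1 ∷ around _ ++ 5 + m ∷ [])
      (z≤n , s≤s z≤n , 2≤t , ≤-refl , ≤-refl , s≤s (s≤s (s≤s t≤2+m)) , ≤-refl) ≤-refl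
      (λ p → B≢0 p ∷ B≢1 p ∷ ++⁺ (sep-avoids (sep-x p)) (B≢K-1 p ∷ []))

    three-over-one : (∀ p → Sep 1 (B p)) → (∀ p → Sep 3 (B p)) → (∀ p → B p ≢ 5 + m) → ⊥
    three-over-one sep-y sep-x B≢K-1 = crowded (around 0 ++ 3 ∷ 4 ∷ 5 + m ∷ [])
      (z≤n , ≤-refl , ≤-refl , ≤-refl , ≤-refl , s≤s (s≤s (s≤s (s≤s (s≤s z≤n)))) , ≤-refl) ≤-refl
      (λ p → ++⁺ (sep-avoids (sep-y p)) (sep⇒≢self (sep-x p) ∷ sep⇒≢suc (sep-x p) ∷ B≢K-1 p ∷ []))

    high-over-one : ∀ {t} → 3 ≤ t → t ≤ 3 + m → (∀ p → Sep 1 (B p)) → (∀ p → Sep (suc t) (B p)) → ⊥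
    high-over-one 3≤t t≤3+m sep-y sep-x = crowded (around 0 ++ around _)
      (z≤n , ≤-refl , ≤-refl , 3≤t , ≤-refl , ≤-refl , s≤s (s≤s (s≤s t≤3+m))) ≤-refl
      (λ p → ++⁺ (sep-avoids (sep-y p)) (sep-avoids (sep-x p)))

    with-top-1 : ∀ {x} → 2 ≤ x → 2 + x ≤ 5 + m → (∀ p → Sep x (B p)) → (∀ p → Sep (5 + m) (B p)) →
                 (∀ p → B p ≢ 1) → ⊥
    with-top-1 {suc t} (s≤s 1≤t) x+2≤K-1 sep-x sep-top B≢1 with t ≟ 1
    ... | yes refl = two-and-top sep-x sep-top
    ... | no  t≢1  = middle-and-ends (≤∧≢⇒< 1≤t (≢-sym t≢1)) (+-cancelˡ-≤ 3 _ _ x+2≤K-1) sep-x B≢1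
                       (λ p → sep⇒≢self (sep-top p))

    with-one : ∀ {x} → 3 ≤ x → x ≤ 4 + m → (∀ p → Sep 1 (B p)) → (∀ p → Sep x (B p)) →
               (∀ p → B p ≢ 5 + m) → ⊥
    with-one {suc t} (s≤s 2≤t) x≤K-2 sep-one sep-x B≢K-1 with t ≟ 2
    ... | yes refl = three-over-one sep-one sep-x B≢K-1
    ... | no  t≢2  = high-over-one (≤∧≢⇒< 2≤t (≢-sym t≢2)) (≤-pred x≤K-2) sep-one sep-x

    pair00 : ∀ {x y} → 2 ≤ x → 2 + x ≤ y → y ≤ K → (∀ p → Sep x (B p)) → (∀ p → Sep y (B p)) →
             (5 + m ≤ y → ∀ p → B p ≢ 1) → (x , y) ≡ (2 , K) ⊎ (x , y) ≡ (4 + m , K)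
    pair00 {suc t} {y} (s≤s 1≤t) x+2≤y y≤K sep-x sep-y hub≢1 with y ≟ K | y ≟ 5 + m
    ... | no y≢K | no y≢K-1 = ⊥-elim (low-pair 1≤t x+2≤y
                                 (≤-pred (≤∧≢⇒< (≤-pred (≤∧≢⇒< y≤K y≢K)) y≢K-1)) sep-x sep-y)
    ... | no _   | yes refl = ⊥-elim (with-top-1 (s≤s 1≤t) x+2≤y sep-x sep-y (hub≢1 ≤-refl))
    ... | yes refl | _ with t ≟ 1 | t ≟ 3 + m
    ...   | yes refl | _        = inj₁ refl
    ...   | no _     | yes refl = inj₂ refl
    ...   | no t≢1   | no t≢K-3 = ⊥-elim (middle-and-ends (≤∧≢⇒< 1≤t (≢-sym t≢1))
              (≤-pred (≤∧≢⇒< (+-cancelˡ-≤ 3 _ _ x+2≤y) t≢K-3)) sep-x (hub≢1 (n≤1+n _))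
              (λ p → sep⇒≢pred (sep-y p)))

    pair0K : ∀ {x y} → 2 ≤ x → x ≤ 5 + m → 1 ≤ y → y ≤ 4 + m → Sep x y →
             (∀ p → Sep x (B p)) → (∀ p → Sep y (B p)) →
             (5 + m ≤ x → ∀ p → B p ≢ 1) → (y ≤ 1 → ∀ p → B p ≢ 5 + m) → (x , y) ≡ (5 + m , 1)
    pair0K {suc t} {suc t′} (s≤s 1≤t) x≤K-1 _ y≤K-2 x-y sep-x sep-y hub≢1 hub≢K-1
      with sep⇒apart {suc t} {suc t′} x-y
    ... | inj₁ x+2≤y = ⊥-elim (low-pair 1≤t x+2≤y y≤K-2 sep-x sep-y)
    ... | inj₂ y+2≤x with t′ ≟ 0 | suc t ≟ 5 + m
    ...   | yes refl | yes refl = refl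
    ...   | yes refl | no x≢K-1 =
      ⊥-elim (with-one y+2≤x (≤-pred (≤∧≢⇒< x≤K-1 x≢K-1)) sep-y sep-x (hub≢K-1 ≤-refl))
    ...   | no y≢1   | yes refl = ⊥-elim (with-top-1 (s≤s (n≢0⇒n>0 y≢1)) y+2≤x sep-y sep-x (hub≢1 ≤-refl))
    ...   | no y≢1   | no x≢K-1 =
      ⊥-elim (low-pair (n≢0⇒n>0 y≢1) y+2≤x (≤-pred (≤∧≢⇒< x≤K-1 x≢K-1)) sep-y sep-x)

    sep-au : ∀ p → Sep (L au) (B p)
    sep-au p = adjDiff au (b p) (inj₁ (e-au-b p))

    sep-av : ∀ p → Sep (L av) (B p)
    sep-av p = adjDiff av (b p) (inj₁ (e-av-b p))

    au≢c : ∀ p s → L au ≢ L (hv p s c)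
    au≢c p s = dist2 au (hv p s c) (b p) (λ ()) (λ { (inj₁ ()) ; (inj₂ ()) }) (inj₁ (e-au-b p)) (inj₁ (e-b-c p s))

    av≢c : ∀ p s → L av ≢ L (hv p s c)
    av≢c p s = dist2 av (hv p s c) (b p) (λ ()) (λ { (inj₁ ()) ; (inj₂ ()) }) (inj₁ (e-av-b p)) (inj₁ (e-b-c p s))

    top-au : 5 + m ≤ L au → ∀ p → B p ≢ 1
    top-au high p = AtHub.hub≢1 lab p (high , range au) (au≢c p zero) (au≢c p (suc zero))

    top-av : 5 + m ≤ L av → ∀ p → B p ≢ 1
    top-av high p = AtHub.hub≢1 lab p (high , range av) (av≢c p zero) (av≢c p (suc zero))

    bottom-av : L av ≤ 1 → ∀ p → B p ≢ 5 + m
    bottom-av low p = AtHub.hub≢K-1 lab p low (av≢c p zero) (av≢c p (suc zero))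

  increasing00 : ∀ {x y} → Labelled K 0 0 x y → 2 + x ≤ y → (x , y) ≡ (2 , K) ⊎ (x , y) ≡ (4 + m , K)
  increasing00 l@(lab , u0 , _ , refl , refl) x+2≤y with constraints-of spine l
  ... | (x≥2 , _) , _ , y<K+1 = pair00 x≥2 x+2≤y (≤-pred y<K+1) sep-au sep-av top-av
    where open Hubs lab u0

  classify00 : ∀ {x y} → Labelled K 0 0 x y → Corner00 id K x y
  classify00 l with constraints-of spine l
  ... | (_ , x-y , _) , _ with sep⇒apart x-y
  ...   | inj₁ x+2≤y = [ inj₁ , (λ x,y≡K-2,K → inj₂ (inj₂ (inj₁ x,y≡K-2,K))) ]′ (increasing00 l x+2≤y)
  ...   | inj₂ y+2≤x = [ (λ y,x≡2,K → inj₂ (inj₁ (cong swap y,x≡2,K)))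
                       , (λ y,x≡K-2,K → inj₂ (inj₂ (inj₂ (cong swap y,x≡K-2,K)))) ]′
                       (increasing00 (swap-labelled l) y+2≤x)

  classify0K : ∀ {x y} → Labelled K 0 K x y → (x , y) ≡ (5 + m , 1)
  classify0K l@(lab , u0 , _ , refl , refl) with constraints-of spine l
  ... | (x≥2 , x-y , y-K , 0≢y , x≢K) , x<K+1 , y<K+1 =
    pair0K x≥2 (≤-pred (≤∧≢⇒< (≤-pred x<K+1) x≢K)) (n≢0⇒n>0 (≢-sym 0≢y))
      (+-cancelˡ-≤ 2 _ _ (sep-below (≤-pred y<K+1) y-K)) x-y sep-au sep-av top-au bottom-av
    where open Hubs lab u0

  index≤m : (p : Fin (suc m)) → toℕ p ≤ m
  index≤m = toℕ≤pred[n]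

  -- A copy of H′ as a graph of its own.
  H′ : Gadget
  H′ = record { V = H' m ; E = EH' m ; u = c ; au = c ; av = c ; v = c }

  low-copy : ∀ {cl el} → cl ≤ 1 → el ≤ 1 → cl ≢ el → L21 K H′
  low-copy {cl} {el} cl≤1 el≤1 cl≢el = record
    { L       = ℓ
    ; range   = in-range
    ; adjDiff = λ { x y (inj₁ xy) → sep-edge xy ; x y (inj₂ yx) → sep-sym {ℓ y} (sep-edge yx) }
    ; dist2   = λ x y w x≢y _ xw wy → distinct xw wy x≢y
    }
    where
    ℓ : H' m → ℕ
    ℓ c     = cl
    ℓ d     = K
    ℓ e     = el
    ℓ (f j) = 2 + toℕ j
    ℓ g     = 0
    ℓ h     = 5 + m
    ℓ i     = K
    in-range : ∀ x → ℓ x ≤ K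
    in-range c     = ≤-trans cl≤1 (s≤s z≤n)
    in-range d     = ≤-refl
    in-range e     = ≤-trans el≤1 (s≤s z≤n)
    in-range (f j) = ≤-trans (+-monoʳ-≤ 2 (toℕ≤pred[n] j)) (+-monoʳ-≤ 4 (m≤n+m m 2))
    in-range g     = z≤n
    in-range h     = n≤1+n _
    in-range i     = ≤-refl
    small≤K-2 : ∀ {x} → x ≤ 1 → 2 + x ≤ K
    small≤K-2 x≤1 = ≤-trans (s≤s (s≤s x≤1)) (s≤s (s≤s (s≤s z≤n)))
    f<K-1 : ∀ j → 2 + toℕ j < 5 + m
    f<K-1 j = +-monoʳ-≤ 3 (toℕ≤pred[n] j)
    small≢f : ∀ {x} j → x ≤ 1 → x ≢ 2 + toℕ j
    small≢f j x≤1 = <⇒≢ (≤-trans (s≤s x≤1) (s≤s (s≤s z≤n)))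
    sep-edge : ∀ {x y} → EH' m x y → Sep (ℓ x) (ℓ y)
    sep-edge e-c-d     = apart⇒sep {cl} (inj₁ (small≤K-2 cl≤1))
    sep-edge e-d-e     = apart⇒sep {K} (inj₂ (small≤K-2 el≤1))
    sep-edge e-h-g     = s≤s (s≤s z≤n)
    sep-edge e-g-i     = s≤s (s≤s z≤n)
    sep-edge (e-g-f j) = s≤s (s≤s z≤n)
    sep-edge (e-d-f j) = apart⇒sep {K} (inj₂ (+-monoʳ-≤ 4 (toℕ≤pred[n] j)))
    AdjH : H' m → H' m → Set
    AdjH = Gadget.Adj H′
    f-distinct : ∀ {j j′} → f j ≢ f j′ → 2 + toℕ j ≢ 2 + toℕ j′
    f-distinct fj≢fj′ same = fj≢fj′ (cong f (toℕ-injective (+-cancelˡ-≡ 2 _ _ same)))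
    distinct : ∀ {x y w} → AdjH x w → AdjH w y → x ≢ y → ℓ x ≢ ℓ y
    distinct (inj₁ e-c-d)     (inj₂ e-c-d)      x≢y = ⊥-elim (x≢y refl)
    distinct (inj₁ e-c-d)     (inj₁ e-d-e)      _   = cl≢el
    distinct (inj₁ e-c-d)     (inj₁ (e-d-f j))  _   = small≢f j cl≤1
    distinct (inj₂ e-d-e)     (inj₂ e-c-d)      _   = ≢-sym cl≢el
    distinct (inj₂ e-d-e)     (inj₁ e-d-e)      x≢y = ⊥-elim (x≢y refl)
    distinct (inj₂ e-d-e)     (inj₁ (e-d-f j))  _   = small≢f j el≤1
    distinct (inj₂ (e-d-f j)) (inj₂ e-c-d)      _   = ≢-sym (small≢f j cl≤1)
    distinct (inj₂ (e-d-f j)) (inj₁ e-d-e)      _   = ≢-sym (small≢f j el≤1)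
    distinct (inj₂ (e-d-f j)) (inj₁ (e-d-f j′)) x≢y = f-distinct x≢y
    distinct (inj₁ e-h-g)     (inj₂ e-h-g)      x≢y = ⊥-elim (x≢y refl)
    distinct (inj₁ e-h-g)     (inj₁ e-g-i)      _   = <⇒≢ ≤-refl
    distinct (inj₁ e-h-g)     (inj₁ (e-g-f j))  _   = ≢-sym (<⇒≢ (f<K-1 j))
    distinct (inj₂ e-g-i)     (inj₂ e-h-g)      _   = ≢-sym (<⇒≢ ≤-refl)
    distinct (inj₂ e-g-i)     (inj₁ e-g-i)      x≢y = ⊥-elim (x≢y refl)
    distinct (inj₂ e-g-i)     (inj₁ (e-g-f j))  _   = ≢-sym (<⇒≢ (m≤n⇒m≤1+n (f<K-1 j)))
    distinct (inj₂ (e-g-f j)) (inj₂ e-h-g)      _   = <⇒≢ (f<K-1 j)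
    distinct (inj₂ (e-g-f j)) (inj₁ e-g-i)      _   = <⇒≢ (m≤n⇒m≤1+n (f<K-1 j))
    distinct (inj₂ (e-g-f j)) (inj₁ (e-g-f j′)) x≢y = f-distinct x≢y
    distinct (inj₁ (e-d-f j)) (inj₂ (e-d-f j))  x≢y = ⊥-elim (x≢y refl)
    distinct (inj₁ (e-d-f j)) (inj₂ (e-g-f j))  _   = λ ()
    distinct (inj₁ (e-g-f j)) (inj₂ (e-d-f j))  _   = λ ()
    distinct (inj₁ (e-g-f j)) (inj₂ (e-g-f j))  x≢y = ⊥-elim (x≢y refl)
    distinct (inj₂ e-c-d)     (inj₁ e-c-d)      x≢y = ⊥-elim (x≢y refl)
    distinct (inj₁ e-d-e)     (inj₂ e-d-e)      x≢y = ⊥-elim (x≢y refl)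
    distinct (inj₂ e-h-g)     (inj₁ e-h-g)      x≢y = ⊥-elim (x≢y refl)
    distinct (inj₁ e-g-i)     (inj₂ e-g-i)      x≢y = ⊥-elim (x≢y refl)

  high-copy : ∀ {cl el} → cl ≤ 1 → el ≤ 1 → cl ≢ el → L21 K H′
  high-copy cl≤1 el≤1 cl≢el = mirror (low-copy cl≤1 el≤1 cl≢el)

  -- A labelling of G_k is assembled from labels of the path, hubs labelled base + p, and a
  -- labelling of each of the two copies of H′ (the same at every hub); the fields below are
  -- exactly the conditions across edges leaving the copies.
  record Frame : Set where
    field
      ℓu ℓau ℓav ℓv base : ℕ
      copy       : Fin 2 → L21 K H′
      path-range : ℓu ≤ K × ℓau ≤ K × ℓav ≤ K × ℓv ≤ K
      hub-range  : base + m ≤ K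
      path-sep   : Sep ℓu ℓau × Sep ℓau ℓav × Sep ℓav ℓv
      path-far   : ℓu ≢ ℓav × ℓau ≢ ℓv
      hub-sep    : ∀ (p : Fin (suc m)) → Sep ℓau (base + toℕ p) × Sep ℓav (base + toℕ p)
      hub-far    : ∀ (p : Fin (suc m)) → ℓu ≢ base + toℕ p × ℓv ≢ base + toℕ p
      spoke-sep  : ∀ (p : Fin (suc m)) s → Sep (base + toℕ p) (L21.L (copy s) c)
      spoke-far  : ∀ (p : Fin (suc m)) s → base + toℕ p ≢ L21.L (copy s) d
      rim-far    : ∀ s → ℓau ≢ L21.L (copy s) c × ℓav ≢ L21.L (copy s) c
      twins-far  : L21.L (copy zero) c ≢ L21.L (copy (suc zero)) c

  framed : Frame → L21 K (G6+ m)
  framed fr = record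
    { L = ℓ ; range = in-range
    ; adjDiff = λ { x y (inj₁ xy) → sep-edge xy ; x y (inj₂ yx) → sep-sym {ℓ y} (sep-edge yx) }
    ; dist2 = λ x y w x≢y x≁y xw wy → distinct xw wy x≢y x≁y }
    where
    open Frame fr
    ℓ : V6 m → ℕ
    ℓ u          = ℓu
    ℓ au         = ℓau
    ℓ av         = ℓav
    ℓ v          = ℓv
    ℓ (b p)      = base + toℕ p
    ℓ (hv p s x) = L21.L (copy s) x
    in-range : ∀ x → ℓ x ≤ K
    in-range u          = proj₁ path-range
    in-range au         = proj₁ (proj₂ path-range)
    in-range av         = proj₁ (proj₂ (proj₂ path-range))
    in-range v          = proj₂ (proj₂ (proj₂ path-range))
    in-range (b p)      = ≤-trans (+-monoʳ-≤ base (index≤m p)) hub-range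
    in-range (hv p s x) = L21.range (copy s) x
    sep-edge : ∀ {x y} → E6 m x y → Sep (ℓ x) (ℓ y)
    sep-edge e-u-au         = proj₁ path-sep
    sep-edge e-au-av        = proj₁ (proj₂ path-sep)
    sep-edge e-av-v         = proj₂ (proj₂ path-sep)
    sep-edge (e-au-b p)     = proj₁ (hub-sep p)
    sep-edge (e-av-b p)     = proj₂ (hub-sep p)
    sep-edge (e-b-c p s)    = spoke-sep p s
    sep-edge (e-H' p s xy)  = L21.adjDiff (copy s) _ _ (inj₁ xy)
    hub-distinct : ∀ {p q} → b {m} p ≢ b q → base + toℕ p ≢ base + toℕ q
    hub-distinct b≢b same = b≢b (cong b (toℕ-injective (+-cancelˡ-≡ base _ _ same)))
    inside : ∀ {p s x y w} → Gadget.Adj H′ x w → Gadget.Adj H′ w y →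
             hv p s x ≢ hv p s y → ¬ Adj (hv p s x) (hv p s y) → L21.L (copy s) x ≢ L21.L (copy s) y
    inside {p} {s} xw wy x≢y x≁y = L21.dist2 (copy s) _ _ _ (λ same → x≢y (cong (hv p s) same))
      (λ { (inj₁ xy) → x≁y (inj₁ (e-H' p s xy)) ; (inj₂ yx) → x≁y (inj₂ (e-H' p s yx)) }) xw wy
    distinct : ∀ {x y w} → Adj x w → Adj w y → x ≢ y → ¬ Adj x y → ℓ x ≢ ℓ y
    distinct (inj₁ (e-H' _ _ xw)) (inj₁ (e-H' _ _ wy)) = inside (inj₁ xw) (inj₁ wy)
    distinct (inj₁ (e-H' _ _ xw)) (inj₂ (e-H' _ _ yw)) = inside (inj₁ xw) (inj₂ yw)
    distinct (inj₂ (e-H' _ _ wx)) (inj₁ (e-H' _ _ wy)) = inside (inj₂ wx) (inj₁ wy)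
    distinct (inj₂ (e-H' _ _ wx)) (inj₂ (e-H' _ _ yw)) = inside (inj₂ wx) (inj₂ yw)
    distinct (inj₂ e-u-au)       (inj₁ e-u-au)       x≢y _   = ⊥-elim (x≢y refl)
    distinct (inj₁ e-av-v)       (inj₂ e-av-v)       x≢y _   = ⊥-elim (x≢y refl)
    distinct (inj₁ e-u-au)       (inj₂ e-u-au)       x≢y _   = ⊥-elim (x≢y refl)
    distinct (inj₁ e-u-au)       (inj₁ e-au-av)      _   _   = proj₁ path-far
    distinct (inj₁ e-u-au)       (inj₁ (e-au-b q))   _   _   = proj₁ (hub-far q)
    distinct (inj₂ e-au-av)      (inj₂ e-u-au)       _   _   = ≢-sym (proj₁ path-far)
    distinct (inj₂ e-au-av)      (inj₁ e-au-av)      x≢y _   = ⊥-elim (x≢y refl)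
    distinct (inj₂ e-au-av)      (inj₁ (e-au-b q))   _   x≁y = ⊥-elim (x≁y (inj₁ (e-av-b q)))
    distinct (inj₂ (e-au-b p))   (inj₂ e-u-au)       _   _   = ≢-sym (proj₁ (hub-far p))
    distinct (inj₂ (e-au-b p))   (inj₁ e-au-av)      _   x≁y = ⊥-elim (x≁y (inj₂ (e-av-b p)))
    distinct (inj₂ (e-au-b p))   (inj₁ (e-au-b q))   x≢y _   = hub-distinct x≢y
    distinct (inj₁ e-au-av)      (inj₂ e-au-av)      x≢y _   = ⊥-elim (x≢y refl)
    distinct (inj₁ e-au-av)      (inj₁ e-av-v)       _   _   = proj₂ path-far
    distinct (inj₁ e-au-av)      (inj₁ (e-av-b q))   _   x≁y = ⊥-elim (x≁y (inj₁ (e-au-b q)))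
    distinct (inj₂ e-av-v)       (inj₂ e-au-av)      _   _   = ≢-sym (proj₂ path-far)
    distinct (inj₂ e-av-v)       (inj₁ e-av-v)       x≢y _   = ⊥-elim (x≢y refl)
    distinct (inj₂ e-av-v)       (inj₁ (e-av-b q))   _   _   = proj₂ (hub-far q)
    distinct (inj₂ (e-av-b p))   (inj₂ e-au-av)      _   x≁y = ⊥-elim (x≁y (inj₂ (e-au-b p)))
    distinct (inj₂ (e-av-b p))   (inj₁ e-av-v)       _   _   = ≢-sym (proj₂ (hub-far p))
    distinct (inj₂ (e-av-b p))   (inj₁ (e-av-b q))   x≢y _   = hub-distinct x≢y
    distinct (inj₁ (e-au-b _))   (inj₂ (e-au-b _))   x≢y _   = ⊥-elim (x≢y refl)
    distinct (inj₁ (e-au-b _))   (inj₂ (e-av-b _))   _   x≁y = ⊥-elim (x≁y (inj₁ e-au-av))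
    distinct (inj₁ (e-au-b _))   (inj₁ (e-b-c _ s))  _   _   = proj₁ (rim-far s)
    distinct (inj₁ (e-av-b _))   (inj₂ (e-au-b _))   _   x≁y = ⊥-elim (x≁y (inj₂ e-au-av))
    distinct (inj₁ (e-av-b _))   (inj₂ (e-av-b _))   x≢y _   = ⊥-elim (x≢y refl)
    distinct (inj₁ (e-av-b _))   (inj₁ (e-b-c _ s))  _   _   = proj₂ (rim-far s)
    distinct (inj₂ (e-b-c _ s))  (inj₂ (e-au-b _))   _   _   = ≢-sym (proj₁ (rim-far s))
    distinct (inj₂ (e-b-c _ s))  (inj₂ (e-av-b _))   _   _   = ≢-sym (proj₂ (rim-far s))
    distinct (inj₂ (e-b-c _ zero))       (inj₁ (e-b-c _ zero))       x≢y _ = ⊥-elim (x≢y refl)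
    distinct (inj₂ (e-b-c _ zero))       (inj₁ (e-b-c _ (suc zero))) _   _ = twins-far
    distinct (inj₂ (e-b-c _ (suc zero))) (inj₁ (e-b-c _ zero))       _   _ = ≢-sym twins-far
    distinct (inj₂ (e-b-c _ (suc zero))) (inj₁ (e-b-c _ (suc zero))) x≢y _ = ⊥-elim (x≢y refl)
    distinct (inj₁ (e-b-c _ _))  (inj₂ (e-b-c _ _))  x≢y _   = ⊥-elim (x≢y refl)
    distinct (inj₁ (e-b-c p s))  (inj₁ (e-H' _ _ e-c-d)) _ _ = spoke-far p s
    distinct (inj₂ (e-H' p s e-c-d)) (inj₂ (e-b-c _ _)) _ _  = ≢-sym (spoke-far p s)

  low₀₁ low₁₀ high₁₀ high₀₁ : L21 K H′
  low₀₁  = low-copy z≤n (s≤s z≤n) (λ ())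
  low₁₀  = low-copy (s≤s z≤n) z≤n (λ ())
  high₁₀ = high-copy (s≤s z≤n) z≤n (λ ())
  high₀₁ = high-copy z≤n (s≤s z≤n) (λ ())

  ≢K : ∀ {x} → x < 5 + m → x ≢ K
  ≢K x<K-1 = <⇒≢ (m≤n⇒m≤1+n x<K-1)

  ≢high-d : ∀ x → suc x ≢ K ∸ K
  ≢high-d x same = 1+n≢0 (trans same (n∸n≡0 K))

  frame-2-K : Frame
  frame-2-K = record
    { ℓu = 0 ; ℓau = 2 ; ℓav = K ; ℓv = 0 ; base = 4
    ; copy       = λ { zero → low₀₁ ; (suc zero) → low₁₀ }
    ; path-range = z≤n , s≤s (s≤s z≤n) , ≤-refl , z≤n
    ; hub-range  = +-monoˡ-≤ m (s≤s (s≤s (s≤s (s≤s z≤n))))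
    ; path-sep   = s≤s (s≤s z≤n) , apart⇒sep {2} {K} (inj₁ (m≤m+n 4 (2 + m))) , s≤s (s≤s z≤n)
    ; path-far   = (λ ()) , (λ ())
    ; hub-sep    = λ p → apart⇒sep {2} {4 + toℕ p} (inj₁ (m≤m+n 4 _)) , apart⇒sep {K} {4 + toℕ p} (inj₂ (+-monoʳ-≤ 6 (index≤m p)))
    ; hub-far    = λ p → (λ ()) , (λ ())
    ; spoke-sep  = λ p → λ { zero → s≤s (s≤s z≤n) ; (suc zero) → s≤s (s≤s z≤n) }
    ; spoke-far  = λ p → λ { zero → ≢K (+-monoʳ-≤ 5 (index≤m p)) ; (suc zero) → ≢K (+-monoʳ-≤ 5 (index≤m p)) }
    ; rim-far    = λ { zero → (λ ()) , (λ ()) ; (suc zero) → (λ ()) , (λ ()) }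
    ; twins-far  = λ ()
    }

  frame-K-2-K : Frame
  frame-K-2-K = record
    { ℓu = 0 ; ℓau = 4 + m ; ℓav = K ; ℓv = 0 ; base = 2
    ; copy       = λ { zero → high₁₀ ; (suc zero) → low₀₁ }
    ; path-range = z≤n , ≤-trans (n≤1+n _) (n≤1+n _) , ≤-refl , z≤n
    ; hub-range  = +-monoˡ-≤ m (s≤s (s≤s z≤n))
    ; path-sep   = s≤s (s≤s z≤n) , apart⇒sep {4 + m} {K} (inj₁ ≤-refl) , s≤s (s≤s z≤n)
    ; path-far   = (λ ()) , (λ ())
    ; hub-sep    = λ p → apart⇒sep {4 + m} {2 + toℕ p} (inj₂ (+-monoʳ-≤ 4 (index≤m p)))
                       , apart⇒sep {K} {2 + toℕ p} (inj₂ (≤-trans (+-monoʳ-≤ 4 (index≤m p)) (≤-trans (n≤1+n _) (n≤1+n _))))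
    ; hub-far    = λ p → (λ ()) , (λ ())
    ; spoke-sep  = λ p → λ { zero → apart⇒sep {2 + toℕ p} {5 + m} (inj₁ (≤-trans (+-monoʳ-≤ 4 (index≤m p)) (n≤1+n _)))
                           ; (suc zero) → s≤s (s≤s z≤n) }
    ; spoke-far  = λ p → λ { zero → ≢high-d _ ; (suc zero) → ≢K (≤-trans (+-monoʳ-≤ 3 (index≤m p)) (+-monoʳ-≤ 3 (m≤n+m m 2))) }
    ; rim-far    = λ { zero → <⇒≢ ≤-refl , ≢-sym (<⇒≢ ≤-refl) ; (suc zero) → (λ ()) , (λ ()) }
    ; twins-far  = λ ()
    }

  frame-K-1-1 : Frame
  frame-K-1-1 = record
    { ℓu = 0 ; ℓau = 5 + m ; ℓav = 1 ; ℓv = K ; base = 3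
    ; copy       = λ { zero → low₀₁ ; (suc zero) → high₀₁ }
    ; path-range = z≤n , n≤1+n _ , s≤s z≤n , ≤-refl
    ; hub-range  = +-monoˡ-≤ m (s≤s (s≤s (s≤s z≤n)))
    ; path-sep   = s≤s (s≤s z≤n) , s≤s (s≤s z≤n) , s≤s (s≤s z≤n)
    ; path-far   = (λ ()) , <⇒≢ ≤-refl
    ; hub-sep    = λ p → apart⇒sep {5 + m} {3 + toℕ p} (inj₂ (+-monoʳ-≤ 5 (index≤m p))) , s≤s (s≤s z≤n)
    ; hub-far    = λ p → (λ ()) , ≢-sym (≢K (+-monoʳ-≤ 4 (≤-trans (index≤m p) (n≤1+n m))))
    ; spoke-sep  = λ p → λ { zero → s≤s (s≤s z≤n)
                           ; (suc zero) → apart⇒sep {3 + toℕ p} {K} (inj₁ (≤-trans (+-monoʳ-≤ 5 (index≤m p)) (n≤1+n _))) }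
    ; spoke-far  = λ p → λ { zero → ≢K (+-monoʳ-≤ 4 (≤-trans (index≤m p) (n≤1+n m))) ; (suc zero) → ≢high-d _ }
    ; rim-far    = λ { zero → (λ ()) , (λ ()) ; (suc zero) → <⇒≢ ≤-refl , (λ ()) }
    ; twins-far  = λ ()
    }

  realise00 : ∀ {x y} → Corner00 id K x y → Labelled K 0 0 x y
  realise00 (inj₁ refl)               = framed frame-2-K , refl , refl , refl , refl
  realise00 (inj₂ (inj₁ refl))        = swap-labelled (realise00 (inj₁ refl))
  realise00 (inj₂ (inj₂ (inj₁ refl))) = framed frame-K-2-K , refl , refl , refl , refl
  realise00 (inj₂ (inj₂ (inj₂ refl))) = swap-labelled (realise00 (inj₂ (inj₂ (inj₁ refl))))

  realise0K : Labelled K 0 K (5 + m) 1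
  realise0K = framed frame-K-1-1 , refl , refl , refl , refl

data Kind : ℕ → Set where
  four  : Kind 4
  five  : Kind 5
  large : ∀ m → Kind (6 + m)

kind : ∀ k → 4 ≤ k → Kind k
kind 4 _ = four
kind 5 _ = five
kind (suc (suc (suc (suc (suc (suc m)))))) _ = large m
kind 0 ()
kind 1 (s≤s ())
kind 2 (s≤s (s≤s ()))
kind 3 (s≤s (s≤s (s≤s ())))

realise00 : ∀ k → 4 ≤ k → ∀ {x y} → Corner00 id k x y → Labelled k 0 0 x y
realise00 k 4≤k with kind k 4≤k
... | four    = realise00-4
... | five    = realise00-5
... | large m = Large.realise00 m

classify00 : ∀ k → 4 ≤ k → ∀ {x y} → Labelled k 0 0 x y → Corner00 id k x y
classify00 k 4≤k with kind k 4≤k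
... | four    = classify00-4
... | five    = classify00-5
... | large m = Large.classify00 m

realise0K : ∀ k → 4 ≤ k → Labelled k 0 k (k ∸ 1) 1
realise0K k 4≤k with kind k 4≤k
... | four    = realise0K-4
... | five    = realise0K-5
... | large m = Large.realise0K m

classify0K : ∀ k → 4 ≤ k → ∀ {x y} → Labelled k 0 k x y → (x , y) ≡ (k ∸ 1 , 1)
classify0K k 4≤k with kind k 4≤k
... | four    = classify0K-4
... | five    = classify0K-5
... | large m = Large.classify0K m

mirror-labelled : ∀ {k α β x y} → Labelled k α β x y → Labelled k (k ∸ α) (k ∸ β) (k ∸ x) (k ∸ y)
mirror-labelled (lab , refl , refl , refl , refl) = mirror lab , refl , refl , refl , refl

relabelled : ∀ {k α β x y α′ β′ x′ y′} → Labelled k α β x y →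
             α ≡ α′ → β ≡ β′ → x ≡ x′ → y ≡ y′ → Labelled k α′ β′ x′ y′
relabelled l refl refl refl refl = l

k∸[k∸2]≡2 : ∀ {k} → 4 ≤ k → k ∸ (k ∸ 2) ≡ 2
k∸[k∸2]≡2 4≤k = m∸[m∸n]≡n (≤-trans (s≤s (s≤s z≤n)) 4≤k)

k∸[k∸1]≡1 : ∀ {k} → 4 ≤ k → k ∸ (k ∸ 1) ≡ 1
k∸[k∸1]≡1 4≤k = m∸[m∸n]≡n (≤-trans (s≤s z≤n) 4≤k)

unreflect² : ∀ {k x y s t s′ t′} → x ≤ k → y ≤ k → (k ∸ x , k ∸ y) ≡ (s , t) →
             k ∸ s ≡ s′ → k ∸ t ≡ t′ → (x , y) ≡ (s′ , t′)
unreflect² x≤k y≤k refl s′ t′ =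
  cong₂ _,_ (trans (sym (m∸[m∸n]≡n x≤k)) s′) (trans (sym (m∸[m∸n]≡n y≤k)) t′)

-- The corners (k, k) and (k, 0) are the reflections of (0, 0) and (0, k).
classifyKK : ∀ k → 4 ≤ k → ∀ {x y} → Labelled k k k x y → CornerKK id k x y
classifyKK k 4≤k l@(lab , _ , _ , refl , refl) =
  reflect-corner (classify00 k 4≤k (relabelled (mirror-labelled l) (n∸n≡0 k) (n∸n≡0 k) refl refl))
  where
  open L21 lab
  module Gk = Gadget (G k)
  back : ∀ {s t s′ t′} → (k ∸ L Gk.au , k ∸ L Gk.av) ≡ (s , t) → k ∸ s ≡ s′ → k ∸ t ≡ t′ →
         (L Gk.au , L Gk.av) ≡ (s′ , t′)
  back = unreflect² (range Gk.au) (range Gk.av)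
  reflect-corner : Corner00 id k (k ∸ L Gk.au) (k ∸ L Gk.av) → CornerKK id k (L Gk.au) (L Gk.av)
  reflect-corner (inj₁ same)               = inj₂ (inj₂ (inj₁ (back same refl (n∸n≡0 k))))
  reflect-corner (inj₂ (inj₁ same))        = inj₂ (inj₂ (inj₂ (back same (n∸n≡0 k) refl)))
  reflect-corner (inj₂ (inj₂ (inj₁ same))) = inj₁ (back same (k∸[k∸2]≡2 4≤k) (n∸n≡0 k))
  reflect-corner (inj₂ (inj₂ (inj₂ same))) = inj₂ (inj₁ (back same (n∸n≡0 k) (k∸[k∸2]≡2 4≤k)))

reflect00 : ∀ k → 4 ≤ k → ∀ {s t x y} → Corner00 id k s t → k ∸ s ≡ x → k ∸ t ≡ y → Labelled k k k x y
reflect00 k 4≤k corner = relabelled (mirror-labelled (realise00 k 4≤k corner)) refl refl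

realiseKK : ∀ k → 4 ≤ k → ∀ {x y} → CornerKK id k x y → Labelled k k k x y
realiseKK k 4≤k (inj₁ refl)               = reflect00 k 4≤k (inj₂ (inj₂ (inj₁ refl))) (k∸[k∸2]≡2 4≤k) (n∸n≡0 k)
realiseKK k 4≤k (inj₂ (inj₁ refl))        = reflect00 k 4≤k (inj₂ (inj₂ (inj₂ refl))) (n∸n≡0 k) (k∸[k∸2]≡2 4≤k)
realiseKK k 4≤k (inj₂ (inj₂ (inj₁ refl))) = reflect00 k 4≤k (inj₁ refl) refl (n∸n≡0 k)
realiseKK k 4≤k (inj₂ (inj₂ (inj₂ refl))) = reflect00 k 4≤k (inj₂ (inj₁ refl)) (n∸n≡0 k) refl

classifyK0 : ∀ k → 4 ≤ k → ∀ {x y} → Labelled k k 0 x y → (x , y) ≡ (1 , k ∸ 1)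
classifyK0 k 4≤k l@(lab , _ , _ , refl , refl) =
  unreflect² (range (Gadget.au (G k))) (range (Gadget.av (G k)))
    (classify0K k 4≤k (relabelled (mirror-labelled l) (n∸n≡0 k) refl refl refl)) (k∸[k∸1]≡1 4≤k) refl
  where open L21 lab

realiseK0 : ∀ k → 4 ≤ k → Labelled k k 0 1 (k ∸ 1)
realiseK0 k 4≤k = relabelled (mirror-labelled (realise0K k 4≤k)) refl (n∸n≡0 k) (k∸[k∸1]≡1 4≤k) refl

Realisable : ℕ → ℕ → ℕ → ℤ → ℤ → Set
Realisable k α β x y = Σ (L21 k (G k)) λ lab → let open L21 lab ; module Gk = Gadget (G k) in
  L Gk.u ≡ α × L Gk.v ≡ β × + L Gk.au ≡ x × + L Gk.av ≡ y

Admissible : {A : Set} → (ℕ → A) → ℕ → ℕ → ℕ → A → A → Set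
Admissible ι k α β x y =
    ((α ≡ 0 × β ≡ 0) → Corner00 ι k x y) × ((α ≡ k × β ≡ k) → CornerKK ι k x y)
  × ((α ≡ k × β ≡ 0) → (x , y) ≡ (ι 1 , ι (k ∸ 1))) × ((α ≡ 0 × β ≡ k) → (x , y) ≡ (ι (k ∸ 1) , ι 1))

pair-ℤ : ∀ {x y s t : ℕ} → (x , y) ≡ (s , t) → _≡_ {A = ℤ × ℤ} (+ x , + y) (+ s , + t)
pair-ℤ refl = refl

oneOf4-ℤ : ∀ {p₁ p₂ p₃ p₄ x y} → OneOf4 id p₁ p₂ p₃ p₄ x y → OneOf4 +_ p₁ p₂ p₃ p₄ (+ x) (+ y)
oneOf4-ℤ = Sum.map pair-ℤ (Sum.map pair-ℤ (Sum.map pair-ℤ pair-ℤ))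

necessary : ∀ k → 4 ≤ k → ∀ {α β x y} → Realisable k α β x y → Admissible +_ k α β x y
necessary k 4≤k {α} {β} (lab , u-α , v-β , refl , refl) =
    (λ (α0 , β0) → oneOf4-ℤ (classify00 k 4≤k (ends α0 β0)))
  , (λ (αk , βk) → oneOf4-ℤ (classifyKK k 4≤k (ends αk βk)))
  , (λ (αk , β0) → pair-ℤ (classifyK0 k 4≤k (ends αk β0)))
  , (λ (α0 , βk) → pair-ℤ (classify0K k 4≤k (ends α0 βk)))
  where
  ends : ∀ {α′ β′} → α ≡ α′ → β ≡ β′ →
         Labelled k α′ β′ (L21.L lab (Gadget.au (G k))) (L21.L lab (Gadget.av (G k)))
  ends α≡α′ β≡β′ = lab , trans u-α α≡α′ , trans v-β β≡β′ , refl , refl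

from-pair : ∀ {k α β s t x y} → (x , y) ≡ (+ s , + t) → Labelled k α β s t → Realisable k α β x y
from-pair refl (lab , u-α , v-β , refl , refl) = lab , u-α , v-β , refl , refl

from-oneOf4 : ∀ {k α β p₁ p₂ p₃ p₄ x y} → (∀ {s t} → OneOf4 id p₁ p₂ p₃ p₄ s t → Labelled k α β s t) →
              OneOf4 +_ p₁ p₂ p₃ p₄ x y → Realisable k α β x y
from-oneOf4 realise (inj₁ same)               = from-pair same (realise (inj₁ refl))
from-oneOf4 realise (inj₂ (inj₁ same))        = from-pair same (realise (inj₂ (inj₁ refl)))
from-oneOf4 realise (inj₂ (inj₂ (inj₁ same))) = from-pair same (realise (inj₂ (inj₂ (inj₁ refl))))
from-oneOf4 realise (inj₂ (inj₂ (inj₂ same))) = from-pair same (realise (inj₂ (inj₂ (inj₂ refl))))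

sufficient : ∀ k → 4 ≤ k → ∀ {α β x y} → α ≡ 0 ⊎ α ≡ k → β ≡ 0 ⊎ β ≡ k →
             Admissible +_ k α β x y → Realisable k α β x y
sufficient k 4≤k (inj₁ refl) (inj₁ refl) (corner , _)         = from-oneOf4 (realise00 k 4≤k) (corner (refl , refl))
sufficient k 4≤k (inj₂ refl) (inj₂ refl) (_ , corner , _)     = from-oneOf4 (realiseKK k 4≤k) (corner (refl , refl))
sufficient k 4≤k (inj₂ refl) (inj₁ refl) (_ , _ , labels , _) = from-pair (labels (refl , refl)) (realiseK0 k 4≤k)
sufficient k 4≤k (inj₁ refl) (inj₂ refl) (_ , _ , _ , labels) = from-pair (labels (refl , refl)) (realise0K k 4≤k)

theorem2 : (k : ℕ) → 4 ≤ k → (α β : ℕ) → (α ≡ 0 ⊎ α ≡ k) → (β ≡ 0 ⊎ β ≡ k) → (x y : ℤ) →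
    (Σ (L21 k (G k)) (λ lab →
        L21.L lab (Gadget.u (G k)) ≡ α × L21.L lab (Gadget.v (G k)) ≡ β ×
        + L21.L lab (Gadget.au (G k)) ≡ x × + L21.L lab (Gadget.av (G k)) ≡ y))
    ⇔
    (((α ≡ 0 × β ≡ 0) → ((x , y) ≡ (+ 2 , + k) ⊎ (x , y) ≡ (+ k , + 2) ⊎ (x , y) ≡ (+ (k ∸ 2) , + k) ⊎ (x , y) ≡ (+ k , + (k ∸ 2)))) ×
     ((α ≡ k × β ≡ k) → ((x , y) ≡ (+ 2 , + 0) ⊎ (x , y) ≡ (+ 0 , + 2) ⊎ (x , y) ≡ (+ (k ∸ 2) , + 0) ⊎ (x , y) ≡ (+ 0 , + (k ∸ 2)))) ×
     ((α ≡ k × β ≡ 0) → (x , y) ≡ (+ 1 , + (k ∸ 1))) ×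
     ((α ≡ 0 × β ≡ k) → (x , y) ≡ (+ (k ∸ 1) , + 1)))
theorem2 k 4≤k α β α∈ β∈ x y = mk⇔ (necessary k 4≤k) (sufficient k 4≤k α∈ β∈)
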